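{- Fix $n\geqslant1$. Let $\lambda\subset\mathbb{N}^{3n}$ be a partition with $h_\lambda(1)=3n$ whose socle consists of exactly $n$ points, all of degree $3$. Then $h_\lambda=(1,3n,3n,n)$; in particular $\lambda$ is a compressed M-partition of type $(3n,3n,n)$ of length $3$. Moreover the number of such partitions is \[ \alpha^{3n}_{3n,n,3}=\frac{(3n)!}{6^n\,n!}. \]
   Context: Let $\mathbb{N}=\{0,1,2,\dots\}$ with $\mathbb{N}^k$ ordered componentwise. A partition in $\mathbb{N}^k$ is a finite set $\lambda\subset\mathbb{N}^k$ downward closed for the componentwise order; its size is $|\lambda|$. The degree of a point is the sum of its coordinates; $h_\lambda(i)$ is the number of points of degree $i$ (written as the tuple $(h_\lambda(0),h_\lambda(1),\dots)$); the length $\ell(\lambda)$ is the maximal degree of a point of $\lambda$; $\mathrm{Soc}(\lambda)$ is the set of maximal elements; the socle type is $e_\lambda(i)=$ number of socle elements of degree $i$. A partition is compressed (resp. anti-compressed) if it has maximal (resp. minimal) size among partitions with the same socle type and the same embedding dimension $h_\lambda(1)$. For positive $k,q,m$, an M-partition of type $(k,q,m)$ is a partition $\lambda\subset\mathbb{N}^k$ of size $1+k+q+m$ with all socle elements of degree $\geqslant3$, $h_\lambda(1)=k$, $h_\lambda(2)=q$, $\sum_{i\geqslant3}h_\lambda(i)=m$; $\alpha^k_{q,m,\ell}$ is the number of M-partitions of type $(k,q,m)$ of length $\ell$. -}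

module Defs where

open import Data.Nat using (ℕ; zero; suc; _+_; _*_; _^_; _!; _≤_; _<_; _⊔_; _≟_; _≤?_)
open import Data.Nat.DivMod using (_/_)
open import Data.Nat.Properties using (m*n≢0; m^n≢0; _!≢0)
open import Data.Vec using (Vec; []; _∷_)
import Data.Vec.Properties as VecP
open import Data.Vec.Relation.Binary.Pointwise.Inductive as PW using (Pointwise)
open import Data.Vec.Relation.Binary.Lex.Strict using (Lex-<)
open import Data.List using (List; []; _∷_; length; filter; map; foldr)
open import Data.List.Membership.Propositional using (_∈_)
open import Data.List.Relation.Unary.All as All using (All)
open import Data.List.Relation.Unary.Linked using (Linked)
open import Data.List.Relation.Unary.Unique.Propositional using (Unique)
open import Data.Product using (Σ; _×_)
open import Function.Bundles using (_⇔_)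
open import Relation.Binary.PropositionalEquality using (_≡_)
open import Relation.Nullary using (Dec)
open import Relation.Nullary.Decidable using (_→-dec_)

Pt : ℕ → Set
Pt k = Vec ℕ k

_≤ᵖ_ : ∀ {k} → Pt k → Pt k → Set
_≤ᵖ_ = Pointwise _≤_

_≤ᵖ?_ : ∀ {k} (x y : Pt k) → Dec (x ≤ᵖ y)
_≤ᵖ?_ = PW.decidable _≤?_

-- Strict lexicographic order, used only to make the list representation
-- of a finite set canonical (strictly increasing list, hence no duplicates).
_<ˡ_ : ∀ {k} → Pt k → Pt k → Set
_<ˡ_ = Lex-< _≡_ _<_

deg : ∀ {k} → Pt k → ℕ
deg []       = 0
deg (x ∷ xs) = x + deg xs

-- A finite subset of ℕ^k is represented canonically by the strictly
-- lexicographically increasing list of its elements.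
-- A partition: such a finite set which is downward closed.
IsPartition : ∀ {k} → List (Pt k) → Set
IsPartition {k} L =
  Linked _<ˡ_ L × (∀ {x y : Pt k} → x ∈ L → y ≤ᵖ x → y ∈ L)

size : ∀ {k} → List (Pt k) → ℕ
size = length

IsMaxIn : ∀ {k} → List (Pt k) → Pt k → Set
IsMaxIn L x = All (λ y → x ≤ᵖ y → x ≡ y) L

isMaxIn? : ∀ {k} (L : List (Pt k)) (x : Pt k) → Dec (IsMaxIn L x)
isMaxIn? L x = All.all? (λ y → (x ≤ᵖ? y) →-dec (VecP.≡-dec _≟_ x y)) L

Soc : ∀ {k} → List (Pt k) → List (Pt k)
Soc L = filter (isMaxIn? L) L

h : ∀ {k} → List (Pt k) → ℕ → ℕ
h L i = length (filter (λ x → deg x ≟ i) L)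

h≥3 : ∀ {k} → List (Pt k) → ℕ
h≥3 L = length (filter (λ x → 3 ≤? deg x) L)

e : ∀ {k} → List (Pt k) → ℕ → ℕ
e L i = length (filter (λ x → deg x ≟ i) (Soc L))

len : ∀ {k} → List (Pt k) → ℕ
len L = foldr _⊔_ 0 (map deg L)

at : List ℕ → ℕ → ℕ
at []       _       = 0
at (a ∷ as) zero    = a
at (a ∷ as) (suc i) = at as i

HilbertIs : ∀ {k} → List (Pt k) → List ℕ → Set
HilbertIs L t = ∀ i → h L i ≡ at t i

IsCompressed : ∀ {k} → List (Pt k) → Set
IsCompressed {k} L =
  ∀ (μ : List (Pt k)) → IsPartition μ →
    (∀ i → e μ i ≡ e L i) → h μ 1 ≡ h L 1 → size μ ≤ size L

IsMPartition : (k q m : ℕ) → List (Pt k) → Set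
IsMPartition k q m L =
  IsPartition L × size L ≡ 1 + k + q + m ×
  All (λ x → 3 ≤ deg x) (Soc L) ×
  h L 1 ≡ k × h L 2 ≡ q × h≥3 L ≡ m

-- "P holds for exactly N partitions in ℕ^k": a duplicate-free list of
-- (canonical representations of) partitions listing exactly those with P.
CountIs : ∀ {k} → (List (Pt k) → Set) → ℕ → Set
CountIs {k} P N =
  Σ (List (List (Pt k))) λ Ls →
    Unique Ls × (∀ L → (L ∈ Ls) ⇔ P L) × length Ls ≡ N

αIs : (k q m ℓ N : ℕ) → Set
αIs k q m ℓ N = CountIs {k} (λ L → IsMPartition k q m L × len L ≡ ℓ) N

-- The exact quotient (3n)! / (6^n n!)  (ℕ-division; denominator is nonzero).
formula : ℕ → ℕ
formula n = ((3 * n) !) / (6 ^ n * n !)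
  where instance
    _ = m^n≢0 6 n
    _ = n !≢0
    _ = m*n≢0 (6 ^ n) (n !)

-- Every point of λ lies below a socle element and all 3n unit vectors lie in λ, so the
-- supports of the n socle elements cover the 3n coordinates. Their degrees add up to only
-- 3n, so every socle element is a 0/1-vector and the supports are pairwise disjoint: λ is
-- the union of n cubes {0,1}³ sitting on disjoint triples of coordinates. Counting points
-- by degree in such a union gives h = (1,3n,3n,n), and a partition with the same socle
-- type and embedding dimension has the same shape, hence the same size. Such partitions
-- therefore correspond to the partitions of the 3n coordinates into triples; choosing the
-- two partners of the least remaining coordinate gives f(m+1) = C(3m+2,2) f(m), whence
-- f(n) = (3n)!/(6ⁿ n!).
module Submission where

open import Defs
open import Data.Bool using (true; false; if_then_else_)
open import Data.Empty using (⊥; ⊥-elim)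
open import Data.Unit using (⊤; tt)
open import Data.Fin as Fin using (Fin)
import Data.Fin.Properties as Finₚ
open import Data.List as List using (List; []; _∷_; length; filter; map; foldr; _++_; allFin; concatMap)
import Data.List.Properties as Listₚ
open import Data.List.Membership.Propositional using (_∈_; find; lose)
open import Data.List.Membership.Propositional.Properties
open import Data.List.Membership.Propositional.Properties.WithK using (unique∧set⇒bag)
open import Data.List.Relation.Binary.BagAndSetEquality using (∼bag⇒↭)
open import Data.List.Relation.Binary.Disjoint.Propositional using (Disjoint)
open import Data.List.Relation.Binary.Permutation.Propositional.Properties using (↭-length)
open import Data.List.Relation.Unary.All as All using (All; []; _∷_)
import Data.List.Relation.Unary.All.Properties as Allₚ
open import Data.List.Relation.Unary.All.Properties.Core using (¬All⇒Any¬)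
open import Data.List.Relation.Unary.AllPairs as AllPairs using (AllPairs; []; _∷_)
import Data.List.Relation.Unary.AllPairs.Properties as AllPairsₚ
open import Data.List.Relation.Unary.Any as Any using (Any; here; there)
import Data.List.Relation.Unary.Linked.Properties as Linkedₚ
open import Data.List.Relation.Unary.Unique.Propositional using (Unique)
import Data.List.Relation.Unary.Unique.Propositional.Properties as Uniqueₚ
open import Data.Nat using (ℕ; zero; suc; _+_; _*_; _^_; _!; _≤_; _<_; _⊔_; _≟_; _≤?_; z≤n; s≤s)
open import Data.Nat.Combinatorics using (_C_; nC1≡n; nCk+nC[k+1]≡[n+1]C[k+1])
open import Data.Nat.DivMod using (_/_; m*n/n≡m)
open import Data.Nat.ListAction using (sum)
open import Data.Nat.Properties
open import Data.Nat.Tactic.RingSolver using (solve-∀)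
open import Data.Product using (Σ; ∃; _×_; _,_; proj₁; proj₂)
open import Data.Sum using (_⊎_; inj₁; inj₂; [_,_])
open import Data.Vec as Vec using ([]; _∷_; lookup; replicate; zipWith)
import Data.Vec.Properties as Vecₚ
import Data.Vec.Relation.Binary.Lex.Strict as Lex
open import Data.Vec.Relation.Binary.Lex.Core using (this; next)
open import Data.Vec.Relation.Binary.Pointwise.Inductive as PW using ([]; _∷_)
import Data.Vec.Relation.Unary.All as VecAll
import Data.Vec.Relation.Unary.All.Properties as VecAllₚ
open import Function using (_∘_; id)
open import Function.Bundles using (_⇔_; mk⇔)
open import Relation.Binary.Bundles using (StrictPartialOrder)
open import Relation.Binary.Definitions using (DecidableEquality)
open import Relation.Binary.PropositionalEquality
  using (_≡_; _≢_; refl; sym; trans; cong; cong₂; subst; module ≡-Reasoning)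
open import Relation.Nullary using (Dec; yes; no; ¬_; does)
open import Relation.Nullary.Decidable using (_×-dec_; _⊎-dec_; _→-dec_; ¬?)
open import Level using (0ℓ)
open import Relation.Unary using (Pred; Decidable)

iverson : ∀ {P : Set} → Dec P → ℕ
iverson P? = if does P? then 1 else 0

module _ {A : Set} where

  unique∧set⇒length-≡ : {xs ys : List A} → Unique xs → Unique ys →
                        (∀ {z} → z ∈ xs ⇔ z ∈ ys) → length xs ≡ length ys
  unique∧set⇒length-≡ u v xs⇔ys = ↭-length (∼bag⇒↭ (unique∧set⇒bag u v xs⇔ys))

  AllPairs-irrefl⇒Unique : {R : A → A → Set} → (∀ {x} → ¬ R x x) →
                           ∀ {xs} → AllPairs R xs → Unique xs
  AllPairs-irrefl⇒Unique irr = AllPairs.map (λ { r refl → irr r })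

  AllPairs-strict-set⇒≡ : {R : A → A → Set} → (∀ {x y z} → R x y → R y z → R x z) →
    (∀ {x} → ¬ R x x) → ∀ {xs ys} → AllPairs R xs → AllPairs R ys →
    (∀ {z} → z ∈ xs → z ∈ ys) → (∀ {z} → z ∈ ys → z ∈ xs) → xs ≡ ys
  AllPairs-strict-set⇒≡ tr irr {[]} {[]} _ _ _ _ = refl
  AllPairs-strict-set⇒≡ tr irr {[]} {y ∷ ys} _ _ _ ys⊆ with ys⊆ (here refl)
  ... | ()
  AllPairs-strict-set⇒≡ tr irr {x ∷ xs} {[]} _ _ xs⊆ _ with xs⊆ (here refl)
  ... | ()
  AllPairs-strict-set⇒≡ {R} tr irr {x ∷ xs} {y ∷ ys} (x< ∷ sxs) (y< ∷ sys) xs⊆ ys⊆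
    with heads-≡
    where
    heads-≡ : x ≡ y
    heads-≡ with xs⊆ (here refl) | ys⊆ (here refl)
    ... | here x≡y | _        = x≡y
    ... | there _  | here y≡x = sym y≡x
    ... | there x∈ | there y∈ = ⊥-elim (irr (tr (All.lookup x< y∈) (All.lookup y< x∈)))
  ... | refl = cong (x ∷_) (AllPairs-strict-set⇒≡ tr irr sxs sys
                 (λ z∈ → tail x< z∈ (xs⊆ (there z∈))) (λ z∈ → tail y< z∈ (ys⊆ (there z∈))))
    where
    tail : ∀ {zs ws z} → All (R x) zs → z ∈ zs → z ∈ x ∷ ws → z ∈ ws
    tail x<zs z∈ (here refl) = ⊥-elim (irr (All.lookup x<zs z∈))
    tail x<zs z∈ (there z∈ws) = z∈ws

  Unique⇒AllPairs : ∀ {S : A → A → Set} {xs} → Unique xs →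
    (∀ {x y} → x ∈ xs → y ∈ xs → x ≢ y → S x y) → AllPairs S xs
  Unique⇒AllPairs []         _ = []
  Unique⇒AllPairs (x∉ ∷ uxs) S-apart =
    All.tabulate (λ y∈ → S-apart (here refl) (there y∈) (All.lookup x∉ y∈))
    ∷ Unique⇒AllPairs uxs (λ p q → S-apart (there p) (there q))

  Unique-map⁺ : ∀ {B : Set} (f : A → B) {xs} → Unique xs →
    (∀ {x y} → x ∈ xs → y ∈ xs → f x ≡ f y → x ≡ y) → Unique (map f xs)
  Unique-map⁺ f {[]} _ _ = []
  Unique-map⁺ f {x ∷ xs} (x∉ ∷ u) inj =
    Allₚ.map⁺ (All.tabulate (λ y∈ fx≡fy → All.lookup x∉ y∈ (inj (here refl) (there y∈) fx≡fy)))
    ∷ Unique-map⁺ f u (λ p q → inj (there p) (there q))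

  module _ {P : Pred A 0ℓ} (P? : Decidable P) where

    length-filter-∷ : ∀ x xs → length (filter P? (x ∷ xs)) ≡ iverson (P? x) + length (filter P? xs)
    length-filter-∷ x xs with does (P? x)
    ... | true  = refl
    ... | false = refl

    length-filter-++ : ∀ xs ys → length (filter P? (xs ++ ys)) ≡ length (filter P? xs) + length (filter P? ys)
    length-filter-++ xs ys = trans (cong length (Listₚ.filter-++ P? xs ys)) (Listₚ.length-++ (filter P? xs))

    length-filter-map : ∀ {B : Set} (f : B → A) xs →
      length (filter P? (map f xs)) ≡ length (filter (P? ∘ f) xs)
    length-filter-map f [] = refl
    length-filter-map f (x ∷ xs) with does (P? (f x))
    ... | true  = cong suc (length-filter-map f xs)
    ... | false = length-filter-map f xs

    length-filter-filter : ∀ {Q : Pred A 0ℓ} (Q? : Decidable Q) xs →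
      length (filter P? (filter Q? xs)) ≡ length (filter (λ x → Q? x ×-dec P? x) xs)
    length-filter-filter Q? [] = refl
    length-filter-filter Q? (x ∷ xs) with does (Q? x)
    ... | false = length-filter-filter Q? xs
    ... | true with does (P? x)
    ... | false = length-filter-filter Q? xs
    ... | true  = cong suc (length-filter-filter Q? xs)

    length-filter+length-filter-¬ : ∀ xs →
      length (filter P? xs) + length (filter (¬? ∘ P?) xs) ≡ length xs
    length-filter+length-filter-¬ [] = refl
    length-filter+length-filter-¬ (x ∷ xs) with does (P? x)
    ... | true  = cong suc (length-filter+length-filter-¬ xs)
    ... | false = trans (+-suc _ _) (cong suc (length-filter+length-filter-¬ xs))

  length-concatMap-const : ∀ {B : Set} (f : A → List B) {xs} c →
    (∀ {x} → x ∈ xs → length (f x) ≡ c) → length (concatMap f xs) ≡ length xs * c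
  length-concatMap-const f {[]} c _ = refl
  length-concatMap-const f {x ∷ xs} c len-f =
    trans (Listₚ.length-++ (f x)) (cong₂ _+_ (len-f (here refl)) (length-concatMap-const f c (len-f ∘ there)))

  sum-map-const : ∀ (f : A → ℕ) {c} {xs} → All (λ x → f x ≡ c) xs → sum (map f xs) ≡ length xs * c
  sum-map-const f []            = refl
  sum-map-const f (fx≡c ∷ fxs≡c) = cong₂ _+_ fx≡c (sum-map-const f fxs≡c)

  1≤length⇒∃∈ : {xs : List A} → 1 ≤ length xs → ∃ λ x → x ∈ xs
  1≤length⇒∃∈ {x ∷ _} _ = x , here refl

  length≡2⇒ : {xs : List A} → length xs ≡ 2 → Σ A λ b → Σ A λ c → xs ≡ b ∷ c ∷ []
  length≡2⇒ {b ∷ c ∷ []} _ = b , c , refl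

  foldr-⊔-lub : (f : A → ℕ) (xs : List A) {b : ℕ} → All (λ x → f x ≤ b) xs → foldr _⊔_ 0 (map f xs) ≤ b
  foldr-⊔-lub f [] _ = z≤n
  foldr-⊔-lub f (x ∷ xs) (p ∷ ps) = ⊔-lub p (foldr-⊔-lub f xs ps)

  foldr-⊔-upper : (f : A → ℕ) {xs : List A} {x : A} → x ∈ xs → f x ≤ foldr _⊔_ 0 (map f xs)
  foldr-⊔-upper f {y ∷ xs} (here refl) = m≤m⊔n (f y) _
  foldr-⊔-upper f {y ∷ xs} (there x∈) = ≤-trans (foldr-⊔-upper f x∈) (m≤n⊔m (f y) _)

-- Points of ℕᵏ

_≟ᵖ_ : ∀ {k} → DecidableEquality (Pt k)
_≟ᵖ_ = Vecₚ.≡-dec _≟_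

≤ᵖ-refl : ∀ {k} {x : Pt k} → x ≤ᵖ x
≤ᵖ-refl = PW.refl ≤-refl

≤ᵖ-trans : ∀ {k} {x y z : Pt k} → x ≤ᵖ y → y ≤ᵖ z → x ≤ᵖ z
≤ᵖ-trans = PW.trans ≤-trans

private module LexOrder {k} = StrictPartialOrder (Lex.<-strictPartialOrder <-strictPartialOrder k)

<ˡ-trans : ∀ {k} {x y z : Pt k} → x <ˡ y → y <ˡ z → x <ˡ z
<ˡ-trans = LexOrder.trans

<ˡ-irrefl : ∀ {k} {x : Pt k} → ¬ x <ˡ x
<ˡ-irrefl = LexOrder.irrefl (PW.refl refl)

sorted⇒Unique : ∀ {k} {L : List (Pt k)} → IsPartition L → Unique L
sorted⇒Unique (sorted , _) = AllPairs-irrefl⇒Unique <ˡ-irrefl (Linkedₚ.Linked⇒AllPairs <ˡ-trans sorted)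

deg-mono : ∀ {k} {x y : Pt k} → x ≤ᵖ y → deg x ≤ deg y
deg-mono []       = z≤n
deg-mono (p ∷ ps) = +-mono-≤ p (deg-mono ps)

≤ᵖ∧deg≥⇒≡ : ∀ {k} {x y : Pt k} → x ≤ᵖ y → deg y ≤ deg x → x ≡ y
≤ᵖ∧deg≥⇒≡ [] _ = refl
≤ᵖ∧deg≥⇒≡ {x = a ∷ x} (a≤b ∷ x≤y) deg≤ with m≤n⇒m<n∨m≡n a≤b
... | inj₁ a<b  = ⊥-elim (<⇒≱ (+-mono-<-≤ a<b (deg-mono x≤y)) deg≤)
... | inj₂ refl = cong (a ∷_) (≤ᵖ∧deg≥⇒≡ x≤y (+-cancelˡ-≤ a _ _ deg≤))

≤ᵖ∧≢⇒deg< : ∀ {k} {x y : Pt k} → x ≤ᵖ y → x ≢ y → deg x < deg y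
≤ᵖ∧≢⇒deg< x≤y x≢y = ≤∧≢⇒< (deg-mono x≤y) (λ deg≡ → x≢y (≤ᵖ∧deg≥⇒≡ x≤y (≤-reflexive (sym deg≡))))

≤ᵖ-antisym : ∀ {k} {x y : Pt k} → x ≤ᵖ y → y ≤ᵖ x → x ≡ y
≤ᵖ-antisym x≤y y≤x = ≤ᵖ∧deg≥⇒≡ x≤y (deg-mono y≤x)

deg-zipWith-+ : ∀ {k} (x y : Pt k) → deg (zipWith _+_ x y) ≡ deg x + deg y
deg-zipWith-+ []      []      = refl
deg-zipWith-+ (a ∷ x) (b ∷ y) = trans (cong ((a + b) +_) (deg-zipWith-+ x y)) (+-exchange a b (deg x) (deg y))
  where
  +-exchange : ∀ a b c d → (a + b) + (c + d) ≡ (a + c) + (b + d)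
  +-exchange = solve-∀

deg≥1⇒∃lookup≥1 : ∀ {k} (x : Pt k) → 1 ≤ deg x → ∃ λ i → 1 ≤ lookup x i
deg≥1⇒∃lookup≥1 (zero ∷ x)  d≥1 = let i , xᵢ≥1 = deg≥1⇒∃lookup≥1 x d≥1 in Fin.suc i , xᵢ≥1
deg≥1⇒∃lookup≥1 (suc a ∷ x) _   = Fin.zero , s≤s z≤n

origin : ∀ {k} → Pt k
origin = replicate _ 0

deg-origin : ∀ {k} → deg (origin {k}) ≡ 0
deg-origin {zero}  = refl
deg-origin {suc k} = deg-origin {k}

origin-≤ᵖ : ∀ {k} (x : Pt k) → origin ≤ᵖ x
origin-≤ᵖ []      = []
origin-≤ᵖ (a ∷ x) = z≤n ∷ origin-≤ᵖ x

deg≡0⇒≡origin : ∀ {k} (x : Pt k) → deg x ≡ 0 → x ≡ origin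
deg≡0⇒≡origin []         _   = refl
deg≡0⇒≡origin (zero ∷ x) d≡0 = cong (0 ∷_) (deg≡0⇒≡origin x d≡0)

unit : ∀ {k} → Fin k → Pt k
unit Fin.zero    = 1 ∷ origin
unit (Fin.suc i) = 0 ∷ unit i

deg-unit : ∀ {k} (i : Fin k) → deg (unit i) ≡ 1
deg-unit {suc k} Fin.zero = cong suc (deg-origin {k})
deg-unit (Fin.suc i)      = deg-unit i

deg≡1⇒unit : ∀ {k} (x : Pt k) → deg x ≡ 1 → ∃ λ i → x ≡ unit i
deg≡1⇒unit (zero ∷ x)      d≡1 = let i , x≡ = deg≡1⇒unit x d≡1 in Fin.suc i , cong (0 ∷_) x≡
deg≡1⇒unit (suc zero ∷ x)  d≡1 = Fin.zero , cong (1 ∷_) (deg≡0⇒≡origin x (suc-injective d≡1))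

lookup-unit-≡ : ∀ {k} (i : Fin k) → lookup (unit i) i ≡ 1
lookup-unit-≡ Fin.zero    = refl
lookup-unit-≡ (Fin.suc i) = lookup-unit-≡ i

lookup-unit-≢ : ∀ {k} {i j : Fin k} → i ≢ j → lookup (unit i) j ≡ 0
lookup-unit-≢ {i = Fin.zero}  {Fin.zero}  i≢j = ⊥-elim (i≢j refl)
lookup-unit-≢ {i = Fin.zero}  {Fin.suc j} _   = Vecₚ.lookup-replicate j 0
lookup-unit-≢ {i = Fin.suc i} {Fin.zero}  _   = refl
lookup-unit-≢ {i = Fin.suc i} {Fin.suc j} i≢j = lookup-unit-≢ (i≢j ∘ cong Fin.suc)

unit-injective : ∀ {k} {i j : Fin k} → unit i ≡ unit j → i ≡ j
unit-injective {i = i} {j} uᵢ≡uⱼ with i Finₚ.≟ j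
... | yes i≡j = i≡j
... | no  i≢j with trans (sym (lookup-unit-≡ i)) (trans (cong (λ u → lookup u i) uᵢ≡uⱼ) (lookup-unit-≢ (i≢j ∘ sym)))
... | ()

unit-≤ᵖ⇒1≤lookup : ∀ {k} {i : Fin k} {x : Pt k} → unit i ≤ᵖ x → 1 ≤ lookup x i
unit-≤ᵖ⇒1≤lookup {i = i} {x} uᵢ≤x = subst (_≤ lookup x i) (lookup-unit-≡ i) (PW.lookup uᵢ≤x i)

-- Binary vectors, supports and their sums

IsBinary : ∀ {k} → Pt k → Set
IsBinary = VecAll.All (_≤ 1)

ones : ∀ {k} → Pt k
ones = replicate _ 1

binary⇒≤ᵖones : ∀ {k} {x : Pt k} → IsBinary x → x ≤ᵖ ones
binary⇒≤ᵖones VecAll.[]         = []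
binary⇒≤ᵖones (a≤1 VecAll.∷ bx) = a≤1 ∷ binary⇒≤ᵖones bx

binary-ext : ∀ {k} {x y : Pt k} → IsBinary x → IsBinary y →
  (∀ i → 1 ≤ lookup x i → 1 ≤ lookup y i) → (∀ i → 1 ≤ lookup y i → 1 ≤ lookup x i) → x ≡ y
binary-ext VecAll.[] VecAll.[] _ _ = refl
binary-ext {x = a ∷ x} {b ∷ y} (a≤1 VecAll.∷ bx) (b≤1 VecAll.∷ by) x⇒y y⇒x =
  cong₂ _∷_ (bit-ext a≤1 b≤1 (x⇒y Fin.zero) (y⇒x Fin.zero))
            (binary-ext bx by (x⇒y ∘ Fin.suc) (y⇒x ∘ Fin.suc))
  where
  bit-ext : ∀ {a b} → a ≤ 1 → b ≤ 1 → (1 ≤ a → 1 ≤ b) → (1 ≤ b → 1 ≤ a) → a ≡ b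
  bit-ext z≤n       z≤n       _   _   = refl
  bit-ext (s≤s z≤n) (s≤s z≤n) _   _   = refl
  bit-ext z≤n       (s≤s z≤n) _   b⇒a with b⇒a (s≤s z≤n)
  ... | ()
  bit-ext (s≤s z≤n) z≤n       a⇒b _   with a⇒b (s≤s z≤n)
  ... | ()

indicator : ℕ → ℕ
indicator zero    = 0
indicator (suc _) = 1

indicator-positive : ∀ {a} → 1 ≤ a → indicator a ≡ 1
indicator-positive {suc _} _ = refl

support : ∀ {k} → Pt k → Pt k
support = Vec.map indicator

deg-support≤deg : ∀ {k} (x : Pt k) → deg (support x) ≤ deg x
deg-support≤deg []          = z≤n
deg-support≤deg (zero ∷ x)  = deg-support≤deg x
deg-support≤deg (suc a ∷ x) = s≤s (+-mono-≤ z≤n (deg-support≤deg x))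

deg≤deg-support⇒binary : ∀ {k} (x : Pt k) → deg x ≤ deg (support x) → IsBinary x
deg≤deg-support⇒binary []                 _ = VecAll.[]
deg≤deg-support⇒binary (zero ∷ x)         d≤ = z≤n VecAll.∷ deg≤deg-support⇒binary x d≤
deg≤deg-support⇒binary (suc zero ∷ x)     d≤ = s≤s z≤n VecAll.∷ deg≤deg-support⇒binary x (≤-pred d≤)
deg≤deg-support⇒binary (suc (suc a) ∷ x)  d≤ =
  ⊥-elim (<⇒≱ (+-mono-<-≤ (s≤s (s≤s z≤n)) (deg-support≤deg x)) d≤)

positive⇒dim≤deg : ∀ {k} (v : Pt k) → (∀ i → 1 ≤ lookup v i) → k ≤ deg v
positive⇒dim≤deg []      _   = z≤n
positive⇒dim≤deg (a ∷ v) pos = +-mono-≤ (pos Fin.zero) (positive⇒dim≤deg v (pos ∘ Fin.suc))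

positive∧deg≤dim⇒≤1 : ∀ {k} (v : Pt k) → (∀ i → 1 ≤ lookup v i) → deg v ≤ k → ∀ i → lookup v i ≤ 1
positive∧deg≤dim⇒≤1 {suc k} (a ∷ v) pos d≤ Fin.zero =
  +-cancelʳ-≤ k a 1 (≤-trans (+-monoʳ-≤ a (positive⇒dim≤deg v (pos ∘ Fin.suc))) d≤)
positive∧deg≤dim⇒≤1 {suc k} (a ∷ v) pos d≤ (Fin.suc i) =
  positive∧deg≤dim⇒≤1 v (pos ∘ Fin.suc) (+-cancelˡ-≤ 1 _ _ (≤-trans (+-monoˡ-≤ (deg v) (pos Fin.zero)) d≤)) i

DisjointSupport : ∀ {k} → Pt k → Pt k → Set
DisjointSupport s t = ∀ i → lookup s i ≡ 0 ⊎ lookup t i ≡ 0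

disjoint⇒shared-coordinate⇒≡ : ∀ {k} {T : List (Pt k)} → AllPairs DisjointSupport T →
  ∀ {t t' i} → t ∈ T → t' ∈ T → 1 ≤ lookup t i → 1 ≤ lookup t' i → t ≡ t'
disjoint⇒shared-coordinate⇒≡ (_ ∷ _) (here refl) (here refl) _ _ = refl
disjoint⇒shared-coordinate⇒≡ (t⊥ ∷ _) {i = i} (here refl) (there t'∈) tᵢ≥1 t'ᵢ≥1 with All.lookup t⊥ t'∈ i
... | inj₁ tᵢ≡0  = ⊥-elim (<⇒≱ tᵢ≥1 (≤-reflexive tᵢ≡0))
... | inj₂ t'ᵢ≡0 = ⊥-elim (<⇒≱ t'ᵢ≥1 (≤-reflexive t'ᵢ≡0))
disjoint⇒shared-coordinate⇒≡ (t'⊥ ∷ _) {i = i} (there t∈) (here refl) tᵢ≥1 t'ᵢ≥1 with All.lookup t'⊥ t∈ i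
... | inj₁ t'ᵢ≡0 = ⊥-elim (<⇒≱ t'ᵢ≥1 (≤-reflexive t'ᵢ≡0))
... | inj₂ tᵢ≡0  = ⊥-elim (<⇒≱ tᵢ≥1 (≤-reflexive tᵢ≡0))
disjoint⇒shared-coordinate⇒≡ (_ ∷ ⊥T) (there t∈) (there t'∈) = disjoint⇒shared-coordinate⇒≡ ⊥T t∈ t'∈

disjoint∧nonzero⇒Unique : ∀ {k} {T : List (Pt k)} → AllPairs DisjointSupport T →
  All (λ t → 1 ≤ deg t) T → Unique T
disjoint∧nonzero⇒Unique [] [] = []
disjoint∧nonzero⇒Unique {T = t ∷ T} (t⊥ ∷ ⊥T) (d≥1 ∷ ds≥1) =
  All.map (λ { t⊥t refl → self-disjoint⇒⊥ t⊥t }) t⊥ ∷ disjoint∧nonzero⇒Unique ⊥T ds≥1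
  where
  self-disjoint⇒⊥ : DisjointSupport t t → ⊥
  self-disjoint⇒⊥ t⊥t with deg≥1⇒∃lookup≥1 t d≥1
  ... | i , tᵢ≥1 with t⊥t i
  ... | inj₁ tᵢ≡0 = <⇒≱ tᵢ≥1 (≤-reflexive tᵢ≡0)
  ... | inj₂ tᵢ≡0 = <⇒≱ tᵢ≥1 (≤-reflexive tᵢ≡0)

module _ {k : ℕ} where

  supportSum : List (Pt k) → Pt k
  supportSum []      = origin
  supportSum (t ∷ T) = zipWith _+_ (support t) (supportSum T)

  lookup-supportSum-∷ : ∀ t (T : List (Pt k)) i →
    lookup (supportSum (t ∷ T)) i ≡ indicator (lookup t i) + lookup (supportSum T) i
  lookup-supportSum-∷ t T i =
    trans (Vecₚ.lookup-zipWith _+_ i (support t) (supportSum T))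
          (cong (_+ lookup (supportSum T) i) (Vecₚ.lookup-map i indicator t))

  covered⇒1≤lookup-supportSum : ∀ {T t} i → t ∈ T → 1 ≤ lookup t i → 1 ≤ lookup (supportSum T) i
  covered⇒1≤lookup-supportSum {t ∷ T} i (here refl) tᵢ≥1 =
    subst (1 ≤_) (sym (lookup-supportSum-∷ t T i))
          (≤-trans (≤-reflexive (sym (indicator-positive tᵢ≥1))) (m≤m+n _ _))
  covered⇒1≤lookup-supportSum {u ∷ T} i (there t∈) tᵢ≥1 =
    subst (1 ≤_) (sym (lookup-supportSum-∷ u T i))
          (≤-trans (covered⇒1≤lookup-supportSum i t∈ tᵢ≥1) (m≤n+m _ _))

  deg-supportSum : (T : List (Pt k)) → deg (supportSum T) ≡ sum (map (deg ∘ support) T)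
  deg-supportSum []      = deg-origin {k}
  deg-supportSum (t ∷ T) = trans (deg-zipWith-+ (support t) (supportSum T)) (cong (deg (support t) +_) (deg-supportSum T))

  Σdeg-support≤Σdeg : (T : List (Pt k)) → sum (map (deg ∘ support) T) ≤ sum (map deg T)
  Σdeg-support≤Σdeg []      = z≤n
  Σdeg-support≤Σdeg (t ∷ T) = +-mono-≤ (deg-support≤deg t) (Σdeg-support≤Σdeg T)

  Σdeg≤Σdeg-support⇒binary : (T : List (Pt k)) → sum (map deg T) ≤ sum (map (deg ∘ support) T) → All IsBinary T
  Σdeg≤Σdeg-support⇒binary []      _ = []
  Σdeg≤Σdeg-support⇒binary (t ∷ T) Σ≤ with m≤n⇒m<n∨m≡n (deg-support≤deg t)
  ... | inj₁ d< = ⊥-elim (<⇒≱ (+-mono-<-≤ d< (Σdeg-support≤Σdeg T)) Σ≤)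
  ... | inj₂ d≡ = deg≤deg-support⇒binary t (≤-reflexive (sym d≡))
                ∷ Σdeg≤Σdeg-support⇒binary T (+-cancelˡ-≤ (deg t) _ _ (subst (λ d → deg t + _ ≤ d + _) d≡ Σ≤))

  supportSum≤1⇒disjoint : (T : List (Pt k)) → (∀ i → lookup (supportSum T) i ≤ 1) → AllPairs DisjointSupport T
  supportSum≤1⇒disjoint []      _  = []
  supportSum≤1⇒disjoint (t ∷ T) ≤1 =
    All.tabulate (λ t'∈ i → disjoint-at t'∈ i) ∷ supportSum≤1⇒disjoint T (λ i → ≤-trans (m≤n+m _ _) (tail≤1 i))
    where
    tail≤1 : ∀ i → indicator (lookup t i) + lookup (supportSum T) i ≤ 1
    tail≤1 i = subst (_≤ 1) (lookup-supportSum-∷ t T i) (≤1 i)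
    disjoint-at : ∀ {t'} → t' ∈ T → ∀ i → lookup t i ≡ 0 ⊎ lookup t' i ≡ 0
    disjoint-at {t'} t'∈ i with lookup t i in tᵢ≡ | lookup t' i in t'ᵢ≡
    ... | zero  | _     = inj₁ refl
    ... | suc _ | zero  = inj₂ refl
    ... | suc _ | suc _ =
      ⊥-elim (<⇒≱ (s≤s (covered⇒1≤lookup-supportSum i t'∈ (subst (1 ≤_) (sym t'ᵢ≡) (s≤s z≤n))))
                  (subst (λ a → indicator a + _ ≤ 1) tᵢ≡ (tail≤1 i)))

  -- Covering all k coordinates with total degree at most k forces every coordinate to be
  -- counted exactly once in the sum of supports.
  module TightCover {T : List (Pt k)} (cover : ∀ i → Any (λ t → 1 ≤ lookup t i) T)
                    (Σdeg≤k : sum (map deg T) ≤ k) where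

    private
      supportSum-positive : ∀ i → 1 ≤ lookup (supportSum T) i
      supportSum-positive i with find (cover i)
      ... | t , t∈ , tᵢ≥1 = covered⇒1≤lookup-supportSum i t∈ tᵢ≥1

      k≤Σdeg-support : k ≤ sum (map (deg ∘ support) T)
      k≤Σdeg-support = subst (k ≤_) (deg-supportSum T) (positive⇒dim≤deg (supportSum T) supportSum-positive)

    binary : All IsBinary T
    binary = Σdeg≤Σdeg-support⇒binary T (≤-trans Σdeg≤k k≤Σdeg-support)

    disjoint : AllPairs DisjointSupport T
    disjoint = supportSum≤1⇒disjoint T (positive∧deg≤dim⇒≤1 (supportSum T) supportSum-positive
                 (≤-trans (≤-reflexive (deg-supportSum T)) (≤-trans (Σdeg-support≤Σdeg T) Σdeg≤k)))

-- Down-sets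

layers : ∀ {k} → ℕ → List (Pt k) → List (Pt (suc k))
layers zero    xs = map (0 ∷_) xs
layers (suc v) xs = layers v xs ++ map (suc v ∷_) xs

downSet : ∀ {k} → Pt k → List (Pt k)
downSet []      = [] ∷ []
downSet (v ∷ s) = layers v (downSet s)

∈-map-∷⁻ : ∀ {k a b} {x : Pt k} {xs : List (Pt k)} → (a ∷ x) ∈ map (b ∷_) xs → a ≡ b × x ∈ xs
∈-map-∷⁻ {xs = _ ∷ _}  (here refl) = refl , here refl
∈-map-∷⁻ {xs = _ ∷ xs} (there p)   = let a≡b , x∈ = ∈-map-∷⁻ {xs = xs} p in a≡b , there x∈

∈-layers⁺ : ∀ {k a v} {x : Pt k} {xs} → a ≤ v → x ∈ xs → (a ∷ x) ∈ layers v xs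
∈-layers⁺ {v = zero} z≤n x∈ = ∈-map⁺ (0 ∷_) x∈
∈-layers⁺ {a = a} {v = suc v} {xs = xs} a≤ x∈ with m≤n⇒m<n∨m≡n a≤
... | inj₁ (s≤s a≤v) = ∈-++⁺ˡ (∈-layers⁺ a≤v x∈)
... | inj₂ refl      = ∈-++⁺ʳ (layers v xs) (∈-map⁺ (suc v ∷_) x∈)

∈-layers⁻ : ∀ {k a v} {x : Pt k} {xs} → (a ∷ x) ∈ layers v xs → a ≤ v × x ∈ xs
∈-layers⁻ {v = zero} p = let a≡0 , x∈ = ∈-map-∷⁻ p in ≤-reflexive a≡0 , x∈
∈-layers⁻ {v = suc v} {xs = xs} p with ∈-++⁻ (layers v xs) p
... | inj₁ q = let a≤v , x∈ = ∈-layers⁻ {v = v} q in m≤n⇒m≤1+n a≤v , x∈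
... | inj₂ q = let a≡ , x∈ = ∈-map-∷⁻ q in ≤-reflexive a≡ , x∈

∈-downSet⁺ : ∀ {k} {x s : Pt k} → x ≤ᵖ s → x ∈ downSet s
∈-downSet⁺ []       = here refl
∈-downSet⁺ (p ∷ ps) = ∈-layers⁺ p (∈-downSet⁺ ps)

∈-downSet⁻ : ∀ {k} {x s : Pt k} → x ∈ downSet s → x ≤ᵖ s
∈-downSet⁻ {x = []}    {[]}    _ = []
∈-downSet⁻ {x = a ∷ x} {v ∷ s} p = let a≤v , x∈ = ∈-layers⁻ {v = v} p in a≤v ∷ ∈-downSet⁻ x∈

sorted-layers : ∀ {k} v {xs : List (Pt k)} → AllPairs _<ˡ_ xs → AllPairs _<ˡ_ (layers v xs)
sorted-layers zero sxs = AllPairsₚ.map⁺ (AllPairs.map (next refl) sxs)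
sorted-layers (suc v) {xs} sxs =
  AllPairsₚ.++⁺ (sorted-layers v sxs) (AllPairsₚ.map⁺ (AllPairs.map (next refl) sxs))
                (All.tabulate (λ y∈ → All.tabulate (λ z∈ → lower<top y∈ z∈)))
  where
  lower<top : ∀ {y z} → y ∈ layers v xs → z ∈ map (suc v ∷_) xs → y <ˡ z
  lower<top {a ∷ y} {b ∷ z} y∈ z∈ with ∈-layers⁻ {v = v} y∈ | ∈-map-∷⁻ z∈
  ... | a≤v , _ | refl , _ = this (s≤s a≤v) refl

sorted-downSet : ∀ {k} (s : Pt k) → AllPairs _<ˡ_ (downSet s)
sorted-downSet []      = [] ∷ []
sorted-downSet (v ∷ s) = sorted-layers v (sorted-downSet s)

Unique-downSet : ∀ {k} (s : Pt k) → Unique (downSet s)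
Unique-downSet s = AllPairs-irrefl⇒Unique <ˡ-irrefl (sorted-downSet s)

-- countSubsets Q? w is the number of subsets of a w-element set whose size satisfies Q.
countSubsets : ∀ {Q : ℕ → Set} → Decidable Q → ℕ → ℕ
countSubsets Q? zero    = iverson (Q? 0)
countSubsets Q? (suc w) = countSubsets Q? w + countSubsets (Q? ∘ suc) w

count-downSet-binary : ∀ {k} {Q : ℕ → Set} (Q? : Decidable Q) (s : Pt k) → IsBinary s →
  length (filter (Q? ∘ deg) (downSet s)) ≡ countSubsets Q? (deg s)
count-downSet-binary Q? [] _ with does (Q? 0)
... | true  = refl
... | false = refl
count-downSet-binary Q? (zero ∷ s) (_ VecAll.∷ bs) =
  trans (length-filter-map (Q? ∘ deg) (0 ∷_) (downSet s)) (count-downSet-binary Q? s bs)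
count-downSet-binary Q? (suc zero ∷ s) (_ VecAll.∷ bs) =
  trans (length-filter-++ (Q? ∘ deg) (map (0 ∷_) (downSet s)) (map (1 ∷_) (downSet s)))
    (cong₂ _+_ (trans (length-filter-map (Q? ∘ deg) (0 ∷_) (downSet s)) (count-downSet-binary Q? s bs))
               (trans (length-filter-map (Q? ∘ deg) (1 ∷_) (downSet s)) (count-downSet-binary (Q? ∘ suc) s bs)))
count-downSet-binary Q? (suc (suc _) ∷ s) (s≤s () VecAll.∷ _)

-- Unions of cubes with disjoint supports

Below : ∀ {k} → List (Pt k) → Pt k → Set
Below T x = Any (x ≤ᵖ_) T

record IsCubeUnion {k} (d : ℕ) (L T : List (Pt k)) : Set where
  field
    isPartition : IsPartition L
    binary      : All IsBinary T
    deg≡        : All (λ t → deg t ≡ d) T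
    disjoint    : AllPairs DisjointSupport T
    nonEmpty    : 1 ≤ length T
    ∈⇒below     : ∀ {x} → x ∈ L → Below T x
    below⇒∈     : ∀ {x} → Below T x → x ∈ L

cubeUnion-≡ : ∀ {k d d'} {L L' T T' : List (Pt k)} → IsCubeUnion d L T → IsCubeUnion d' L' T' →
  (∀ {t} → t ∈ T → t ∈ T') → (∀ {t} → t ∈ T' → t ∈ T) → L ≡ L'
cubeUnion-≡ H H' T⊆T' T'⊆T =
  AllPairs-strict-set⇒≡ <ˡ-trans <ˡ-irrefl (sorted H) (sorted H') (transfer H H' T⊆T') (transfer H' H T'⊆T)
  where
  open IsCubeUnion
  sorted : ∀ {d L T} → IsCubeUnion d L T → AllPairs _<ˡ_ L
  sorted H = Linkedₚ.Linked⇒AllPairs <ˡ-trans (proj₁ (isPartition H))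
  transfer : ∀ {d d' L L' T T'} → IsCubeUnion d L T → IsCubeUnion d' L' T' →
    (∀ {t} → t ∈ T → t ∈ T') → ∀ {x} → x ∈ L → x ∈ L'
  transfer H H' T⊆T' x∈ with find (∈⇒below H x∈)
  ... | t , t∈ , x≤t = below⇒∈ H' (lose (T⊆T' t∈) x≤t)

nonzeroBelow : ∀ {k} → List (Pt k) → List (Pt k)
nonzeroBelow []      = []
nonzeroBelow (t ∷ T) = filter (λ x → 1 ≤? deg x) (downSet t) ++ nonzeroBelow T

module _ {k : ℕ} where

  private
    nonzero? : Decidable (λ (x : Pt k) → 1 ≤ deg x)
    nonzero? x = 1 ≤? deg x

  ∈-nonzeroBelow⁺ : ∀ {T : List (Pt k)} {x} → Below T x → 1 ≤ deg x → x ∈ nonzeroBelow T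
  ∈-nonzeroBelow⁺ {t ∷ T} (here x≤t) d≥1 = ∈-++⁺ˡ (∈-filter⁺ nonzero? (∈-downSet⁺ x≤t) d≥1)
  ∈-nonzeroBelow⁺ {t ∷ T} (there b)  d≥1 = ∈-++⁺ʳ (filter nonzero? (downSet t)) (∈-nonzeroBelow⁺ b d≥1)

  ∈-nonzeroBelow⁻ : ∀ {T : List (Pt k)} {x} → x ∈ nonzeroBelow T → Below T x × 1 ≤ deg x
  ∈-nonzeroBelow⁻ {t ∷ T} x∈ with ∈-++⁻ (filter nonzero? (downSet t)) x∈
  ... | inj₁ x∈t = let x∈↓t , d≥1 = ∈-filter⁻ nonzero? x∈t in here (∈-downSet⁻ x∈↓t) , d≥1
  ... | inj₂ x∈T = let b , d≥1 = ∈-nonzeroBelow⁻ x∈T in there b , d≥1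

  Unique-nonzeroBelow : ∀ {T : List (Pt k)} → AllPairs DisjointSupport T → Unique (nonzeroBelow T)
  Unique-nonzeroBelow [] = []
  Unique-nonzeroBelow {t ∷ T} (t⊥ ∷ ⊥T) =
    Uniqueₚ.++⁺ (Uniqueₚ.filter⁺ nonzero? (Unique-downSet t)) (Unique-nonzeroBelow ⊥T) apart
    where
    apart : Disjoint (filter nonzero? (downSet t)) (nonzeroBelow T)
    apart {x} (x∈t , x∈T) with ∈-filter⁻ nonzero? {xs = downSet t} x∈t | find (proj₁ (∈-nonzeroBelow⁻ {T} x∈T))
    ... | x∈↓t , d≥1 | t' , t'∈ , x≤t' with deg≥1⇒∃lookup≥1 x d≥1
    ... | i , xᵢ≥1 with All.lookup t⊥ t'∈ i
    ... | inj₁ tᵢ≡0  = <⇒≱ (≤-trans xᵢ≥1 (PW.lookup (∈-downSet⁻ {s = t} x∈↓t) i)) (≤-reflexive tᵢ≡0)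
    ... | inj₂ t'ᵢ≡0 = <⇒≱ (≤-trans xᵢ≥1 (PW.lookup x≤t' i)) (≤-reflexive t'ᵢ≡0)

  count-nonzeroBelow : ∀ {d} {Q : ℕ → Set} (Q? : Decidable Q) (T : List (Pt k)) → All IsBinary T →
    All (λ t → deg t ≡ d) T →
    length (filter (Q? ∘ deg) (nonzeroBelow T)) ≡ length T * countSubsets (λ j → 1 ≤? j ×-dec Q? j) d
  count-nonzeroBelow Q? [] [] [] = refl
  count-nonzeroBelow {d} Q? (t ∷ T) (bt ∷ bT) (refl ∷ dT) =
    trans (length-filter-++ (Q? ∘ deg) (filter nonzero? (downSet t)) (nonzeroBelow T))
      (cong₂ _+_ (trans (length-filter-filter (Q? ∘ deg) nonzero? (downSet t))
                        (count-downSet-binary (λ j → 1 ≤? j ×-dec Q? j) t bt))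
                 (count-nonzeroBelow Q? T bT dT))

module CubeUnion {k d : ℕ} (1≤d : 1 ≤ d) {L T : List (Pt k)} (H : IsCubeUnion d L T) where
  open IsCubeUnion H

  Unique-L : Unique L
  Unique-L = sorted⇒Unique isPartition

  Unique-T : Unique T
  Unique-T = disjoint∧nonzero⇒Unique disjoint (All.map (λ { refl → 1≤d }) deg≡)

  generator∈L : ∀ {t} → t ∈ T → t ∈ L
  generator∈L t∈ = below⇒∈ (lose t∈ ≤ᵖ-refl)

  ∈-Soc⁻ : ∀ {x} → x ∈ Soc L → x ∈ T
  ∈-Soc⁻ x∈S with ∈-filter⁻ (isMaxIn? L) x∈S
  ... | x∈ , x-max with find (∈⇒below x∈)
  ... | t , t∈ , x≤t with All.lookup x-max (generator∈L t∈) x≤t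
  ... | refl = t∈

  ∈-Soc⁺ : ∀ {t} → t ∈ T → t ∈ Soc L
  ∈-Soc⁺ {t} t∈ = ∈-filter⁺ (isMaxIn? L) (generator∈L t∈) (All.tabulate maximal)
    where
    -- whatever lies above t lies below some t', which shares a coordinate with t, so t' = t
    maximal : ∀ {y} → y ∈ L → t ≤ᵖ y → t ≡ y
    maximal y∈ t≤y with find (∈⇒below y∈)
    ... | t' , t'∈ , y≤t' with deg≥1⇒∃lookup≥1 t (subst (1 ≤_) (sym (All.lookup deg≡ t∈)) 1≤d)
    ... | i , tᵢ≥1 with disjoint⇒shared-coordinate⇒≡ disjoint t∈ t'∈ tᵢ≥1
                          (≤-trans tᵢ≥1 (PW.lookup (≤ᵖ-trans t≤y y≤t') i))
    ... | refl = ≤ᵖ-antisym t≤y y≤t'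

  length-Soc : length (Soc L) ≡ length T
  length-Soc = unique∧set⇒length-≡ (Uniqueₚ.filter⁺ (isMaxIn? L) Unique-L) Unique-T (mk⇔ ∈-Soc⁻ ∈-Soc⁺)

  len≡d : len L ≡ d
  len≡d = ≤-antisym (foldr-⊔-lub deg L (All.tabulate deg≤d)) d≤len
    where
    deg≤d : ∀ {x} → x ∈ L → deg x ≤ d
    deg≤d {x} x∈ with find (∈⇒below x∈)
    ... | t , t∈ , x≤t = subst (deg x ≤_) (All.lookup deg≡ t∈) (deg-mono x≤t)
    d≤len : d ≤ len L
    d≤len with 1≤length⇒∃∈ nonEmpty
    ... | t , t∈ = subst (_≤ len L) (All.lookup deg≡ t∈) (foldr-⊔-upper deg (generator∈L t∈))

  private
    origin∈L : origin ∈ L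
    origin∈L with 1≤length⇒∃∈ nonEmpty
    ... | t , t∈ = below⇒∈ (lose t∈ (origin-≤ᵖ t))

    ∈L⇒∈origin∷nonzeroBelow : ∀ {x} → x ∈ L → x ∈ origin ∷ nonzeroBelow T
    ∈L⇒∈origin∷nonzeroBelow {x} x∈ with deg x ≟ 0
    ... | yes d≡0 = here (deg≡0⇒≡origin x d≡0)
    ... | no  d≢0 = there (∈-nonzeroBelow⁺ (∈⇒below x∈) (n≢0⇒n>0 d≢0))

    ∈origin∷nonzeroBelow⇒∈L : ∀ {x} → x ∈ origin ∷ nonzeroBelow T → x ∈ L
    ∈origin∷nonzeroBelow⇒∈L (here refl) = origin∈L
    ∈origin∷nonzeroBelow⇒∈L (there x∈)  = below⇒∈ (proj₁ (∈-nonzeroBelow⁻ x∈))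

    Unique-origin∷nonzeroBelow : Unique (origin ∷ nonzeroBelow T)
    Unique-origin∷nonzeroBelow =
      All.tabulate (λ x∈ origin≡x → <⇒≱ (proj₂ (∈-nonzeroBelow⁻ {k} {T} x∈))
                                        (≤-reflexive (trans (cong deg (sym origin≡x)) (deg-origin {k}))))
      ∷ Unique-nonzeroBelow disjoint

  -- L is the origin together with the nonzero points of the |T| disjoint cubes.
  count-deg : ∀ {Q : ℕ → Set} (Q? : Decidable Q) →
    length (filter (Q? ∘ deg) L) ≡ iverson (Q? 0) + length T * countSubsets (λ j → 1 ≤? j ×-dec Q? j) d
  count-deg Q? = begin
    length (filter (Q? ∘ deg) L)
      ≡⟨ unique∧set⇒length-≡ (Uniqueₚ.filter⁺ (Q? ∘ deg) Unique-L)
                             (Uniqueₚ.filter⁺ (Q? ∘ deg) Unique-origin∷nonzeroBelow)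
                             (mk⇔ (along ∈L⇒∈origin∷nonzeroBelow) (along ∈origin∷nonzeroBelow⇒∈L)) ⟩
    length (filter (Q? ∘ deg) (origin ∷ nonzeroBelow T))
      ≡⟨ length-filter-∷ (Q? ∘ deg) origin (nonzeroBelow T) ⟩
    iverson (Q? (deg (origin {k}))) + length (filter (Q? ∘ deg) (nonzeroBelow T))
      ≡⟨ cong₂ _+_ (cong (iverson ∘ Q?) (deg-origin {k})) (count-nonzeroBelow Q? T binary deg≡) ⟩
    iverson (Q? 0) + length T * countSubsets (λ j → 1 ≤? j ×-dec Q? j) d ∎
    where
    open ≡-Reasoning
    along : ∀ {xs ys} → (∀ {x} → x ∈ xs → x ∈ ys) → ∀ {x} → x ∈ filter (Q? ∘ deg) xs → x ∈ filter (Q? ∘ deg) ys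
    along xs⊆ys x∈ = let x∈xs , qx = ∈-filter⁻ (Q? ∘ deg) x∈ in ∈-filter⁺ (Q? ∘ deg) (xs⊆ys x∈xs) qx

-- Partitions whose socle lies in a single degree

below-Soc : ∀ {k} (L : List (Pt k)) {x} → x ∈ L → Below (Soc L) x
below-Soc L {x} x∈ = climb (len L) x∈ (m≤n+m (len L) (deg x))
  where
  -- The fuel f bounds how often the degree can still strictly increase inside L.
  climb : ∀ f {x} → x ∈ L → len L ≤ deg x + f → Below (Soc L) x
  climb f {x} x∈ len≤ with isMaxIn? L x
  ... | yes x-max = lose (∈-filter⁺ (isMaxIn? L) x∈ x-max) ≤ᵖ-refl
  ... | no ¬x-max with find (¬All⇒Any¬ (λ y → (x ≤ᵖ? y) →-dec (x ≟ᵖ y)) L ¬x-max)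
  ... | y , y∈ , ¬[x≤y⇒x≡y] with x ≤ᵖ? y
  ... | no  x≰y = ⊥-elim (¬[x≤y⇒x≡y] (⊥-elim ∘ x≰y))
  ... | yes x≤y = Any.map (≤ᵖ-trans x≤y) (step f len≤)
    where
    x<y : deg x < deg y
    x<y = ≤ᵖ∧≢⇒deg< x≤y (λ x≡y → ¬[x≤y⇒x≡y] (λ _ → x≡y))
    step : ∀ f → len L ≤ deg x + f → Below (Soc L) y
    step zero    len≤ = ⊥-elim (<⇒≱ x<y (≤-trans (foldr-⊔-upper deg y∈) (subst (len L ≤_) (+-identityʳ _) len≤)))
    step (suc f) len≤ = climb f y∈ (≤-trans len≤ (subst (_≤ deg y + f) (sym (+-suc (deg x) f)) (+-monoˡ-≤ f x<y)))

units∈ : ∀ {k} {L : List (Pt k)} → Unique L → h L 1 ≡ k → ∀ i → unit i ∈ L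
units∈ {k} {L} uL h₁≡k i = proj₂ (∈-filter⁻ unit∈L? {xs = allFin k} (subst (i ∈_) (sym all-units) (∈-allFin i)))
  where
  unit∈L? : Decidable (λ i → unit i ∈ L)
  unit∈L? i = Any.any? (unit i ≟ᵖ_) L
  deg≡1? : Decidable (λ (x : Pt k) → deg x ≡ 1)
  deg≡1? x = deg x ≟ 1
  units-of-L : ∀ {x} → x ∈ filter deg≡1? L ⇔ x ∈ map unit (filter unit∈L? (allFin k))
  units-of-L = mk⇔ to from
    where
    to : ∀ {x} → x ∈ filter deg≡1? L → x ∈ map unit (filter unit∈L? (allFin k))
    to {x} x∈ with ∈-filter⁻ deg≡1? {xs = L} x∈
    ... | x∈L , d≡1 with deg≡1⇒unit x d≡1
    ... | j , refl = ∈-map⁺ unit (∈-filter⁺ unit∈L? (∈-allFin j) x∈L)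
    from : ∀ {x} → x ∈ map unit (filter unit∈L? (allFin k)) → x ∈ filter deg≡1? L
    from x∈ with ∈-map⁻ unit x∈
    ... | j , j∈ , refl = ∈-filter⁺ deg≡1? (proj₂ (∈-filter⁻ unit∈L? {xs = allFin k} j∈)) (deg-unit j)
  all-units : filter unit∈L? (allFin k) ≡ allFin k
  all-units = Listₚ.filter-complete unit∈L? (begin
    length (filter unit∈L? (allFin k))             ≡⟨ Listₚ.length-map unit (filter unit∈L? (allFin k)) ⟨
    length (map unit (filter unit∈L? (allFin k)))
      ≡⟨ unique∧set⇒length-≡ (Uniqueₚ.filter⁺ deg≡1? uL) unique-units units-of-L ⟨
    h L 1                                          ≡⟨ h₁≡k ⟩
    k                                              ≡⟨ Listₚ.length-tabulate id ⟨
    length (allFin k)                              ∎)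
    where
    open ≡-Reasoning
    unique-units : Unique (map unit (filter unit∈L? (allFin k)))
    unique-units = Uniqueₚ.map⁺ unit-injective (Uniqueₚ.filter⁺ unit∈L? (Uniqueₚ.allFin⁺ k))

socle-covers : ∀ {k} {L : List (Pt k)} → IsPartition L → h L 1 ≡ k → ∀ i → Any (λ s → 1 ≤ lookup s i) (Soc L)
socle-covers {L = L} isPart h₁≡k i = Any.map unit-≤ᵖ⇒1≤lookup (below-Soc L (units∈ (sorted⇒Unique isPart) h₁≡k i))

socle-isCubeUnion : ∀ {k d} {L : List (Pt k)} → IsPartition L → h L 1 ≡ k →
  All (λ x → deg x ≡ d) (Soc L) → length (Soc L) * d ≤ k → 1 ≤ length (Soc L) → IsCubeUnion d L (Soc L)
socle-isCubeUnion {k} {d} {L} isPart h₁≡k socDeg |S|d≤k 1≤|S| = record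
  { isPartition = isPart
  ; binary      = TightCover.binary cover Σdeg≤k
  ; deg≡        = socDeg
  ; disjoint    = TightCover.disjoint cover Σdeg≤k
  ; nonEmpty    = 1≤|S|
  ; ∈⇒below     = below-Soc L
  ; below⇒∈     = below⇒∈
  }
  where
  cover : ∀ i → Any (λ s → 1 ≤ lookup s i) (Soc L)
  cover = socle-covers isPart h₁≡k
  Σdeg≤k : sum (map deg (Soc L)) ≤ k
  Σdeg≤k = subst (_≤ k) (sym (sum-map-const deg socDeg)) |S|d≤k
  below⇒∈ : ∀ {x} → Below (Soc L) x → x ∈ L
  below⇒∈ b with find b
  ... | s , s∈ , x≤s = proj₂ isPart (proj₁ (∈-filter⁻ (isMaxIn? L) s∈)) x≤s

module CubeUnion₃ {k n : ℕ} {L T : List (Pt k)} (H : IsCubeUnion 3 L T) (|T|≡n : length T ≡ n) where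
  open IsCubeUnion H
  open CubeUnion (s≤s z≤n) H public

  count-deg₃ : ∀ {Q : ℕ → Set} (Q? : Decidable Q) →
    length (filter (Q? ∘ deg) L) ≡ iverson (Q? 0) + n * countSubsets (λ j → 1 ≤? j ×-dec Q? j) 3
  count-deg₃ Q? = trans (count-deg Q?) (cong (λ m → iverson (Q? 0) + m * _) |T|≡n)

  hilbert : HilbertIs L (1 ∷ 3 * n ∷ 3 * n ∷ n ∷ [])
  hilbert 0 = trans (count-deg₃ (_≟ 0)) (cong suc (*-zeroʳ n))
  hilbert 1 = trans (count-deg₃ (_≟ 1)) (*-comm n 3)
  hilbert 2 = trans (count-deg₃ (_≟ 2)) (*-comm n 3)
  hilbert 3 = trans (count-deg₃ (_≟ 3)) (*-identityʳ n)
  hilbert (suc (suc (suc (suc i)))) = trans (count-deg₃ (_≟ 4 + i)) (*-zeroʳ n)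

  h≥3≡n : h≥3 L ≡ n
  h≥3≡n = trans (count-deg₃ (3 ≤?_)) (*-identityʳ n)

  size≡1+7n : size L ≡ 1 + n * 7
  size≡1+7n = trans (sym (cong length (Listₚ.filter-all any? {xs = L} (All.tabulate (λ _ → tt)))))
                    (count-deg₃ (λ _ → yes tt))
    where
    any? : Decidable (λ (_ : Pt k) → ⊤)
    any? _ = yes tt

  Soc-deg≡3 : All (λ x → deg x ≡ 3) (Soc L)
  Soc-deg≡3 = All.tabulate (All.lookup deg≡ ∘ ∈-Soc⁻)

  e₃≡n : e L 3 ≡ n
  e₃≡n = trans (cong length (Listₚ.filter-all (λ x → deg x ≟ 3) Soc-deg≡3)) (trans length-Soc |T|≡n)

  e≡0 : ∀ i → i ≢ 3 → e L i ≡ 0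
  e≡0 i i≢3 = cong length (Listₚ.filter-none (λ x → deg x ≟ i)
                (All.map (λ d≡3 d≡i → i≢3 (trans (sym d≡i) d≡3)) Soc-deg≡3))

socle-isCubeUnion₃ : ∀ {n} {L : List (Pt (3 * n))} → 1 ≤ n → IsPartition L → h L 1 ≡ 3 * n →
  length (Soc L) ≡ n → All (λ x → deg x ≡ 3) (Soc L) → IsCubeUnion 3 L (Soc L)
socle-isCubeUnion₃ {n} 1≤n isPart h₁≡3n |S|≡n socDeg =
  socle-isCubeUnion isPart h₁≡3n socDeg (≤-reflexive (trans (cong (_* 3) |S|≡n) (*-comm n 3)))
                    (subst (1 ≤_) (sym |S|≡n) 1≤n)

cubeUnion₃-isMPartition : ∀ {n} {L T : List (Pt (3 * n))} → IsCubeUnion 3 L T → length T ≡ n →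
  IsMPartition (3 * n) (3 * n) n L
cubeUnion₃-isMPartition {n} H |T|≡n =
  isPartition , trans size≡1+7n (7n≡3n+3n+n n) , All.map (≤-reflexive ∘ sym) Soc-deg≡3 ,
  hilbert 1 , hilbert 2 , h≥3≡n
  where
  open IsCubeUnion H using (isPartition)
  open CubeUnion₃ H |T|≡n
  7n≡3n+3n+n : ∀ n → 1 + n * 7 ≡ 1 + 3 * n + 3 * n + n
  7n≡3n+3n+n = solve-∀

-- A partition with the same socle type and embedding dimension is again a union of n
-- cubes {0,1}³, so it has the same size 1 + 7n.
cubeUnion₃-compressed : ∀ {n} {L T : List (Pt (3 * n))} → 1 ≤ n → IsCubeUnion 3 L T → length T ≡ n →
  IsCompressed L
cubeUnion₃-compressed {n} {L} 1≤n H |T|≡n μ isPartμ eμ≡eL h₁μ≡h₁L =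
  ≤-reflexive (trans (CubeUnion₃.size≡1+7n Hμ |Socμ|≡n) (sym size≡1+7n))
  where
  open CubeUnion₃ H |T|≡n
  Socμ-deg≡3 : All (λ x → deg x ≡ 3) (Soc μ)
  Socμ-deg≡3 = All.tabulate deg≡3
    where
    deg≡3 : ∀ {x} → x ∈ Soc μ → deg x ≡ 3
    deg≡3 {x} x∈ with deg x ≟ 3
    ... | yes d≡3 = d≡3
    ... | no  d≢3 = ⊥-elim (<⇒≱ (Listₚ.filter-some (λ y → deg y ≟ deg x) (lose x∈ refl))
                                 (≤-reflexive (trans (eμ≡eL (deg x)) (e≡0 (deg x) d≢3))))
  |Socμ|≡n : length (Soc μ) ≡ n
  |Socμ|≡n = trans (sym (cong length (Listₚ.filter-all (λ x → deg x ≟ 3) Socμ-deg≡3))) (trans (eμ≡eL 3) e₃≡n)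
  Hμ : IsCubeUnion 3 μ (Soc μ)
  Hμ = socle-isCubeUnion₃ 1≤n isPartμ (trans h₁μ≡h₁L (hilbert 1)) |Socμ|≡n Socμ-deg≡3

-- Choosing one or two elements of a list

module _ {A : Set} where

  pickOne : List A → List (A × List A)
  pickOne []       = []
  pickOne (x ∷ xs) = (x , xs) ∷ map (λ (y , rest) → y , x ∷ rest) (pickOne xs)

  pickTwo : List A → List (A × A × List A)
  pickTwo []       = []
  pickTwo (x ∷ xs) = map (λ (c , rest) → x , c , rest) (pickOne xs)
                  ++ map (λ (b , c , rest) → b , c , x ∷ rest) (pickTwo xs)

  length-pickOne : ∀ xs → length (pickOne xs) ≡ length xs
  length-pickOne []       = refl
  length-pickOne (x ∷ xs) = cong suc (trans (Listₚ.length-map _ (pickOne xs)) (length-pickOne xs))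

  length-pickTwo : ∀ xs → length (pickTwo xs) ≡ length xs C 2
  length-pickTwo []       = refl
  length-pickTwo (x ∷ xs) = begin
    length (map _ (pickOne xs) ++ map _ (pickTwo xs))  ≡⟨ Listₚ.length-++ (map _ (pickOne xs)) ⟩
    length (map _ (pickOne xs)) + length (map _ (pickTwo xs))
      ≡⟨ cong₂ _+_ (Listₚ.length-map _ (pickOne xs)) (Listₚ.length-map _ (pickTwo xs)) ⟩
    length (pickOne xs) + length (pickTwo xs)          ≡⟨ cong₂ _+_ (length-pickOne xs) (length-pickTwo xs) ⟩
    length xs + length xs C 2                          ≡⟨ cong (_+ length xs C 2) (nC1≡n (length xs)) ⟨
    length xs C 1 + length xs C 2                      ≡⟨ nCk+nC[k+1]≡[n+1]C[k+1] (length xs) 1 ⟩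
    suc (length xs) C 2                                ∎
    where open ≡-Reasoning

  ∈-pickOne⁻ : ∀ {xs c rest} → (c , rest) ∈ pickOne xs → c ∈ xs
  ∈-pickOne⁻ {x ∷ xs} (here refl) = here refl
  ∈-pickOne⁻ {x ∷ xs} (there p) with ∈-map⁻ _ p
  ... | _ , q , refl = there (∈-pickOne⁻ q)

  ∈-pickTwo⁻ : ∀ {xs b c rest} → (b , c , rest) ∈ pickTwo xs → b ∈ xs × c ∈ xs
  ∈-pickTwo⁻ {x ∷ xs} p with ∈-++⁻ (map (λ (c , rest) → x , c , rest) (pickOne xs)) p
  ... | inj₁ q with ∈-map⁻ _ q
  ... | _ , q' , refl = here refl , there (∈-pickOne⁻ q')
  ∈-pickTwo⁻ {x ∷ xs} p | inj₂ q with ∈-map⁻ _ q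
  ... | _ , q' , refl = let b∈ , c∈ = ∈-pickTwo⁻ q' in there b∈ , there c∈

  Unique-pickOne : ∀ {xs} → Unique xs → Unique (pickOne xs)
  Unique-pickOne {[]}     _          = []
  Unique-pickOne {x ∷ xs} (x∉ ∷ uxs) =
    All.tabulate (λ q∈ → head∉ q∈) ∷ Uniqueₚ.map⁺ (λ { refl → refl }) (Unique-pickOne uxs)
    where
    head∉ : ∀ {q} → q ∈ map (λ (y , rest) → y , x ∷ rest) (pickOne xs) → (x , xs) ≢ q
    head∉ q∈ refl with ∈-map⁻ _ q∈
    ... | _ , m , x,xs≡ = All.lookup x∉ (∈-pickOne⁻ m) (cong proj₁ x,xs≡)

  Unique-pickTwo : ∀ {xs} → Unique xs → Unique (pickTwo xs)
  Unique-pickTwo {[]}     _          = []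
  Unique-pickTwo {x ∷ xs} (x∉ ∷ uxs) =
    Uniqueₚ.++⁺ (Uniqueₚ.map⁺ (λ { refl → refl }) (Unique-pickOne uxs))
                (Uniqueₚ.map⁺ (λ { refl → refl }) (Unique-pickTwo uxs)) apart
    where
    apart : Disjoint (map (λ (c , rest) → x , c , rest) (pickOne xs))
                     (map (λ (b , c , rest) → b , c , x ∷ rest) (pickTwo xs))
    apart (p , q) with ∈-map⁻ _ p | ∈-map⁻ _ q
    ... | _ , _ , refl | _ , m , x≡b = All.lookup x∉ (proj₁ (∈-pickTwo⁻ m)) (cong proj₁ x≡b)

  module _ {P : Pred A 0ℓ} (P? : Decidable P) where

    private
      filter-none⁻ : ∀ {xs} → filter P? xs ≡ [] → All (¬_ ∘ P) xs
      filter-none⁻ {[]}     _ = []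
      filter-none⁻ {x ∷ xs} none with P? x
      ... | no ¬px = ¬px ∷ filter-none⁻ none

    pickOne-split : ∀ {xs c rest} → (c , rest) ∈ pickOne xs → Unique xs → P c → (∀ {y} → y ∈ xs → P y → y ≡ c) →
      filter P? xs ≡ c ∷ [] × filter (¬? ∘ P?) xs ≡ rest
    pickOne-split {x ∷ xs} (here refl) (x∉ ∷ _) pc only with P? x
    ... | no ¬px = ⊥-elim (¬px pc)
    ... | yes _  = cong (x ∷_) (Listₚ.filter-none P? ¬P) , Listₚ.filter-all (¬? ∘ P?) ¬P
      where
      ¬P : All (¬_ ∘ P) xs
      ¬P = All.tabulate (λ y∈ py → All.lookup x∉ y∈ (sym (only (there y∈) py)))
    pickOne-split {x ∷ xs} (there p) (x∉ ∷ uxs) pc only with ∈-map⁻ _ p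
    ... | _ , q , refl with P? x
    ... | yes px = ⊥-elim (All.lookup x∉ (∈-pickOne⁻ q) (only (here refl) px))
    ... | no  _  = let P≡ , ¬P≡ = pickOne-split q uxs pc (only ∘ there) in P≡ , cong (x ∷_) ¬P≡

    pickTwo-split : ∀ {xs b c rest} → (b , c , rest) ∈ pickTwo xs → Unique xs → P b → P c →
      (∀ {y} → y ∈ xs → P y → y ≡ b ⊎ y ≡ c) → filter P? xs ≡ b ∷ c ∷ [] × filter (¬? ∘ P?) xs ≡ rest
    pickTwo-split {x ∷ xs} p (x∉ ∷ uxs) pb pc only
      with ∈-++⁻ (map (λ (c , rest) → x , c , rest) (pickOne xs)) p
    ... | inj₁ q with ∈-map⁻ _ q
    ... | _ , q' , refl with P? x
    ... | no ¬px = ⊥-elim (¬px pb)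
    ... | yes _  = let P≡ , ¬P≡ = pickOne-split q' uxs pc only' in cong (x ∷_) P≡ , ¬P≡
      where
      only' : ∀ {y} → y ∈ xs → P y → y ≡ _
      only' y∈ py with only (there y∈) py
      ... | inj₁ refl = ⊥-elim (All.lookup x∉ y∈ refl)
      ... | inj₂ y≡c  = y≡c
    pickTwo-split {x ∷ xs} p (x∉ ∷ uxs) pb pc only | inj₂ q with ∈-map⁻ _ q
    ... | _ , q' , refl with P? x
    ... | yes px = ⊥-elim ([ (λ x≡b → x∉b x≡b) , (λ x≡c → x∉c x≡c) ] (only (here refl) px))
      where
      x∉b = All.lookup x∉ (proj₁ (∈-pickTwo⁻ q'))
      x∉c = All.lookup x∉ (proj₂ (∈-pickTwo⁻ q'))
    ... | no  _  = let P≡ , ¬P≡ = pickTwo-split q' uxs pb pc (only ∘ there) in P≡ , cong (x ∷_) ¬P≡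

    pickOne-complete : ∀ {xs c} → filter P? xs ≡ c ∷ [] → (c , filter (¬? ∘ P?) xs) ∈ pickOne xs
    pickOne-complete {x ∷ xs} P≡ with P? x
    ... | yes _ = let x≡c , none = Listₚ.∷-injective P≡ in
                  here (cong₂ _,_ (sym x≡c) (Listₚ.filter-all (¬? ∘ P?) (filter-none⁻ none)))
    ... | no  _ = there (∈-map⁺ (λ (y , rest) → y , x ∷ rest) (pickOne-complete {xs} P≡))

    pickTwo-complete : ∀ {xs b c} → filter P? xs ≡ b ∷ c ∷ [] → (b , c , filter (¬? ∘ P?) xs) ∈ pickTwo xs
    pickTwo-complete {x ∷ xs} {b} {c} P≡ with P? x
    ... | yes _ = let x≡b , P≡' = Listₚ.∷-injective P≡ in
                  subst (λ z → (z , c , filter (¬? ∘ P?) xs) ∈ pickTwo (x ∷ xs)) x≡b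
                        (∈-++⁺ˡ (∈-map⁺ (λ (c , rest) → x , c , rest) (pickOne-complete {xs} P≡')))
    ... | no  _ = ∈-++⁺ʳ (map (λ (c , rest) → x , c , rest) (pickOne xs))
                         (∈-map⁺ (λ (b , c , rest) → b , c , x ∷ rest) (pickTwo-complete {xs} P≡))

module PickedTwo {A : Set} (_≟ᴬ_ : DecidableEquality A) {xs : List A} (uxs : Unique xs)
                 {b c : A} {rest : List A} (bcr∈ : (b , c , rest) ∈ pickTwo xs) where

  private
    b∨c? : Decidable (λ y → y ≡ b ⊎ y ≡ c)
    b∨c? y = (y ≟ᴬ b) ⊎-dec (y ≟ᴬ c)

    split : filter b∨c? xs ≡ b ∷ c ∷ [] × filter (¬? ∘ b∨c?) xs ≡ rest
    split = pickTwo-split b∨c? bcr∈ uxs (inj₁ refl) (inj₂ refl) (λ _ → id)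

  b∈xs : b ∈ xs
  b∈xs = proj₁ (∈-pickTwo⁻ bcr∈)

  c∈xs : c ∈ xs
  c∈xs = proj₂ (∈-pickTwo⁻ bcr∈)

  b≢c : b ≢ c
  b≢c with subst Unique (proj₁ split) (Uniqueₚ.filter⁺ b∨c? uxs)
  ... | b∉ ∷ _ = All.lookup b∉ (here refl)

  Unique-rest : Unique rest
  Unique-rest = subst Unique (proj₂ split) (Uniqueₚ.filter⁺ (¬? ∘ b∨c?) uxs)

  ∈-rest⁻ : ∀ {y} → y ∈ rest → y ∈ xs × y ≢ b × y ≢ c
  ∈-rest⁻ y∈ with ∈-filter⁻ (¬? ∘ b∨c?) {xs = xs} (subst (_ ∈_) (sym (proj₂ split)) y∈)
  ... | y∈xs , ¬b∨c = y∈xs , ¬b∨c ∘ inj₁ , ¬b∨c ∘ inj₂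

  2+length-rest : 2 + length rest ≡ length xs
  2+length-rest = begin
    length (b ∷ c ∷ []) + length rest
      ≡⟨ cong₂ (λ u v → length u + length v) (proj₁ split) (proj₂ split) ⟨
    length (filter b∨c? xs) + length (filter (¬? ∘ b∨c?) xs)
      ≡⟨ length-filter+length-filter-¬ b∨c? xs ⟩
    length xs ∎
    where open ≡-Reasoning

  rest-unique : ∀ {rest'} → (b , c , rest') ∈ pickTwo xs → rest ≡ rest'
  rest-unique bcr'∈ =
    trans (sym (proj₂ split)) (proj₂ (pickTwo-split b∨c? bcr'∈ uxs (inj₁ refl) (inj₂ refl) (λ _ → id)))

-- Partitions of the coordinates into triples

Triple : ℕ → Set
Triple k = Fin k × Fin k × Fin k

tripleVec : ∀ {k} → Triple k → Pt k
tripleVec (a , b , c) = zipWith _+_ (unit a) (zipWith _+_ (unit b) (unit c))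

_∈ᵗ_ : ∀ {k} → Fin k → Triple k → Set
i ∈ᵗ (a , b , c) = i ≡ a ⊎ i ≡ b ⊎ i ≡ c

Distinct : ∀ {k} → Triple k → Set
Distinct (a , b , c) = a ≢ b × a ≢ c × b ≢ c

lookup-tripleVec : ∀ {k} (a b c i : Fin k) →
  lookup (tripleVec (a , b , c)) i ≡ lookup (unit a) i + (lookup (unit b) i + lookup (unit c) i)
lookup-tripleVec a b c i =
  trans (Vecₚ.lookup-zipWith _+_ i (unit a) _)
        (cong (lookup (unit a) i +_) (Vecₚ.lookup-zipWith _+_ i (unit b) (unit c)))

1≤lookup-tripleVec⁻ : ∀ {k} (t : Triple k) i → 1 ≤ lookup (tripleVec t) i → i ∈ᵗ t
1≤lookup-tripleVec⁻ (a , b , c) i 1≤ with a Finₚ.≟ i | b Finₚ.≟ i | c Finₚ.≟ i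
... | yes refl | _        | _        = inj₁ refl
... | no  _    | yes refl | _        = inj₂ (inj₁ refl)
... | no  _    | no  _    | yes refl = inj₂ (inj₂ refl)
... | no  a≢i  | no  b≢i  | no  c≢i  = ⊥-elim (<⇒≱ 1≤ (≤-reflexive (begin
  lookup (tripleVec (a , b , c)) i
    ≡⟨ lookup-tripleVec a b c i ⟩
  lookup (unit a) i + (lookup (unit b) i + lookup (unit c) i)
    ≡⟨ cong₂ _+_ (lookup-unit-≢ a≢i) (cong₂ _+_ (lookup-unit-≢ b≢i) (lookup-unit-≢ c≢i)) ⟩
  0 ∎)))
  where open ≡-Reasoning

1≤lookup-tripleVec⁺ : ∀ {k} (t : Triple k) {i} → i ∈ᵗ t → 1 ≤ lookup (tripleVec t) i
1≤lookup-tripleVec⁺ (a , b , c) {i} i∈ᵗ = subst (1 ≤_) (sym (lookup-tripleVec a b c i)) (1≤ i∈ᵗ)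
  where
  1≤ : i ∈ᵗ (a , b , c) → 1 ≤ lookup (unit a) i + (lookup (unit b) i + lookup (unit c) i)
  1≤ (inj₁ refl)        = ≤-trans (≤-reflexive (sym (lookup-unit-≡ a))) (m≤m+n _ _)
  1≤ (inj₂ (inj₁ refl)) = ≤-trans (≤-trans (≤-reflexive (sym (lookup-unit-≡ b))) (m≤m+n _ (lookup (unit c) b)))
                                  (m≤n+m _ (lookup (unit a) b))
  1≤ (inj₂ (inj₂ refl)) = ≤-trans (≤-trans (≤-reflexive (sym (lookup-unit-≡ c))) (m≤n+m _ (lookup (unit b) c)))
                                  (m≤n+m _ (lookup (unit a) c))

tripleVec-binary : ∀ {k} (t : Triple k) → Distinct t → IsBinary (tripleVec t)
tripleVec-binary (a , b , c) (a≢b , a≢c , b≢c) = VecAllₚ.lookup⁻ ≤1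
  where
  ≤1 : ∀ i → lookup (tripleVec (a , b , c)) i ≤ 1
  ≤1 i rewrite lookup-tripleVec a b c i with a Finₚ.≟ i | b Finₚ.≟ i | c Finₚ.≟ i
  ... | yes refl | _        | _
    rewrite lookup-unit-≡ a | lookup-unit-≢ (a≢b ∘ sym) | lookup-unit-≢ (a≢c ∘ sym) = ≤-refl
  ... | no  a≢i  | yes refl | _
    rewrite lookup-unit-≢ a≢i | lookup-unit-≡ b | lookup-unit-≢ (b≢c ∘ sym) = ≤-refl
  ... | no  a≢i  | no  b≢i  | _
    rewrite lookup-unit-≢ a≢i | lookup-unit-≢ b≢i = lookup-unit≤1 c i
    where
    lookup-unit≤1 : ∀ {k} (c i : Fin k) → lookup (unit c) i ≤ 1
    lookup-unit≤1 c i with c Finₚ.≟ i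
    ... | yes refl = ≤-reflexive (lookup-unit-≡ c)
    ... | no  c≢i  = subst (_≤ 1) (sym (lookup-unit-≢ c≢i)) z≤n

deg-tripleVec : ∀ {k} (t : Triple k) → deg (tripleVec t) ≡ 3
deg-tripleVec (a , b , c) =
  trans (deg-zipWith-+ (unit a) _) (cong₂ _+_ (deg-unit a)
        (trans (deg-zipWith-+ (unit b) (unit c)) (cong₂ _+_ (deg-unit b) (deg-unit c))))

-- Each triple is led by the first coordinate still available.
triplePartitions : ∀ {k} → ℕ → List (Fin k) → List (List (Triple k))
triplePartitions zero    []         = [] ∷ []
triplePartitions zero    (_ ∷ _)    = []
triplePartitions (suc m) []         = []
triplePartitions (suc m) (a ∷ rest) =
  concatMap (λ (b , c , rest') → map ((a , b , c) ∷_) (triplePartitions m rest')) (pickTwo rest)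

data LedBy {k} (m : ℕ) (a : Fin k) (rest : List (Fin k)) : List (Triple k) → Set where
  led : ∀ {b c rest' Q} → (b , c , rest') ∈ pickTwo rest → Q ∈ triplePartitions m rest' →
        LedBy m a rest ((a , b , c) ∷ Q)

∈-triplePartitions⁻ : ∀ {k m a} {rest : List (Fin k)} {P} → P ∈ triplePartitions (suc m) (a ∷ rest) →
  LedBy m a rest P
∈-triplePartitions⁻ {m = m} {a} {rest} P∈
  with find (∈-concatMap⁻ (λ (b , c , rest') → map ((a , b , c) ∷_) (triplePartitions m rest'))
                          {xs = pickTwo rest} P∈)
... | _ , bcr∈ , P∈blk with ∈-map⁻ _ P∈blk
... | _ , Q∈ , refl = led bcr∈ Q∈

∈-triplePartitions⁺ : ∀ {k m a} {rest : List (Fin k)} {b c rest' Q} → (b , c , rest') ∈ pickTwo rest →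
  Q ∈ triplePartitions m rest' → ((a , b , c) ∷ Q) ∈ triplePartitions (suc m) (a ∷ rest)
∈-triplePartitions⁺ {m = m} {a} {b = b} {c} bcr∈ Q∈ =
  ∈-concatMap⁺ (λ (b , c , rest') → map ((a , b , c) ∷_) (triplePartitions m rest'))
               (lose bcr∈ (∈-map⁺ ((a , b , c) ∷_) Q∈))

record IsTripleFamily {k} (m : ℕ) (avail : List (Fin k)) (P : List (Triple k)) : Set where
  field
    binary    : All (IsBinary ∘ tripleVec) P
    supported : All (λ t → ∀ i → 1 ≤ lookup (tripleVec t) i → i ∈ avail) P
    disjoint  : AllPairs (λ t t' → DisjointSupport (tripleVec t) (tripleVec t')) P
    length≡   : length P ≡ m

triplePartitions-sound : ∀ {k m} {avail : List (Fin k)} {P} → Unique avail → P ∈ triplePartitions m avail →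
  IsTripleFamily m avail P
triplePartitions-sound {m = zero} {[]} _ (here refl) =
  record { binary = [] ; supported = [] ; disjoint = [] ; length≡ = refl }
triplePartitions-sound {m = suc m} {a ∷ rest} (a∉ ∷ urest) P∈ with ∈-triplePartitions⁻ {m = m} {a} {rest} P∈
... | led {b} {c} {rest'} {Q} bcr∈ Q∈ = record
  { binary    = tripleVec-binary (a , b , c) (All.lookup a∉ b∈xs , All.lookup a∉ c∈xs , b≢c) ∷ binary
  ; supported = head-supported ∷ All.map (λ sup i 1≤ → there (proj₁ (∈-rest⁻ (sup i 1≤)))) supported
  ; disjoint  = All.tabulate head-disjoint ∷ disjoint
  ; length≡   = cong suc length≡
  }
  where
  open PickedTwo Finₚ._≟_ urest bcr∈
  open IsTripleFamily (triplePartitions-sound {m = m} Unique-rest Q∈)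
  head-supported : ∀ i → 1 ≤ lookup (tripleVec (a , b , c)) i → i ∈ a ∷ rest
  head-supported i 1≤ with 1≤lookup-tripleVec⁻ (a , b , c) i 1≤
  ... | inj₁ refl        = here refl
  ... | inj₂ (inj₁ refl) = there b∈xs
  ... | inj₂ (inj₂ refl) = there c∈xs
  head-disjoint : ∀ {t} → t ∈ Q → DisjointSupport (tripleVec (a , b , c)) (tripleVec t)
  head-disjoint {t} t∈ i with lookup (tripleVec (a , b , c)) i ≟ 0 | lookup (tripleVec t) i ≟ 0
  ... | yes ≡0 | _      = inj₁ ≡0
  ... | no  _  | yes ≡0 = inj₂ ≡0
  ... | no  ≢0 | no ≢0' with ∈-rest⁻ (All.lookup supported t∈ i (n≢0⇒n>0 ≢0'))
  ... | i∈rest , i≢b , i≢c with 1≤lookup-tripleVec⁻ (a , b , c) i (n≢0⇒n>0 ≢0)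
  ... | inj₁ refl        = ⊥-elim (All.lookup a∉ i∈rest refl)
  ... | inj₂ (inj₁ i≡b) = ⊥-elim (i≢b i≡b)
  ... | inj₂ (inj₂ i≡c) = ⊥-elim (i≢c i≡c)

Unique-triplePartitions : ∀ {k m} {avail : List (Fin k)} → Unique avail → Unique (triplePartitions m avail)
Unique-triplePartitions {m = zero}  {[]}    _ = [] ∷ []
Unique-triplePartitions {m = zero}  {_ ∷ _} _ = []
Unique-triplePartitions {m = suc m} {[]}    _ = []
Unique-triplePartitions {k} {suc m} {a ∷ rest} (_ ∷ urest) =
  Uniqueₚ.concat⁺ (Allₚ.map⁺ (All.tabulate unique-block))
                  (AllPairsₚ.map⁺ (Unique⇒AllPairs (Unique-pickTwo urest) apart))
  where
  block : Fin k × Fin k × List (Fin k) → List (List (Triple k))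
  block (b , c , rest') = map ((a , b , c) ∷_) (triplePartitions m rest')
  unique-block : ∀ {q} → q ∈ pickTwo rest → Unique (block q)
  unique-block bcr∈ = Uniqueₚ.map⁺ (proj₂ ∘ Listₚ.∷-injective)
                                  (Unique-triplePartitions {m = m} (PickedTwo.Unique-rest Finₚ._≟_ urest bcr∈))
  apart : ∀ {q q'} → q ∈ pickTwo rest → q' ∈ pickTwo rest → q ≢ q' → Disjoint (block q) (block q')
  apart bcr∈ bcr'∈ q≢q' (P∈ , P∈') with ∈-map⁻ _ P∈ | ∈-map⁻ _ P∈'
  ... | _ , _ , refl | _ , _ , P≡ with Listₚ.∷-injective P≡
  ... | refl , _ = q≢q' (cong (λ r → _ , _ , r) (PickedTwo.rest-unique Finₚ._≟_ urest bcr∈ bcr'∈))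

module _ {k : ℕ} {a : Fin k} {rest : List (Fin k)} (a∉ : All (a ≢_) rest) (urest : Unique rest) where

  private
    covers? : (v : Pt k) → Decidable (λ y → 1 ≤ lookup v y)
    covers? v y = 1 ≤? lookup v y

  leadingTriple-split : ∀ {b c r} → (b , c , r) ∈ pickTwo rest →
    filter (covers? (tripleVec (a , b , c))) rest ≡ b ∷ c ∷ [] ×
    filter (¬? ∘ covers? (tripleVec (a , b , c))) rest ≡ r
  leadingTriple-split {b} {c} bcr∈ =
    pickTwo-split (covers? (tripleVec (a , b , c))) bcr∈ urest
      (1≤lookup-tripleVec⁺ (a , b , c) (inj₂ (inj₁ refl))) (1≤lookup-tripleVec⁺ (a , b , c) (inj₂ (inj₂ refl))) only
    where
    only : ∀ {y} → y ∈ rest → 1 ≤ lookup (tripleVec (a , b , c)) y → y ≡ b ⊎ y ≡ c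
    only y∈ 1≤ with 1≤lookup-tripleVec⁻ (a , b , c) _ 1≤
    ... | inj₁ refl  = ⊥-elim (All.lookup a∉ y∈ refl)
    ... | inj₂ y≡b∨c = y≡b∨c

  leadingTriple-injective : ∀ {b c r b' c' r'} → (b , c , r) ∈ pickTwo rest → (b' , c' , r') ∈ pickTwo rest →
    tripleVec (a , b , c) ≡ tripleVec (a , b' , c') → (b , c , r) ≡ (b' , c' , r')
  leadingTriple-injective {b} {c} {r} {b'} {c'} {r'} bcr∈ bcr'∈ v≡v'
    with leadingTriple-split bcr∈
       | subst (λ v → filter (covers? v) rest ≡ b' ∷ c' ∷ [] × filter (¬? ∘ covers? v) rest ≡ r')
               (sym v≡v') (leadingTriple-split bcr'∈)
  ... | bc≡ , r≡ | bc'≡ , r'≡ with trans (sym bc≡) bc'≡ | trans (sym r≡) r'≡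
  ... | refl | refl = refl

  leader-uncovered : ∀ {m b c r Q v} → (b , c , r) ∈ pickTwo rest → Q ∈ triplePartitions m r →
    v ∈ map tripleVec Q → ¬ 1 ≤ lookup v a
  leader-uncovered {m} bcr∈ Q∈ v∈ 1≤ with ∈-map⁻ tripleVec v∈
  ... | t , t∈ , refl = All.lookup a∉ (proj₁ (∈-rest⁻ (All.lookup supported t∈ a 1≤))) refl
    where
    open PickedTwo Finₚ._≟_ urest bcr∈
    open IsTripleFamily (triplePartitions-sound {m = m} Unique-rest Q∈)

-- The leading triple is the only one covering the first available coordinate a.
triplePartitions-injective : ∀ {k m} {avail : List (Fin k)} {P P'} → Unique avail →
  P ∈ triplePartitions m avail → P' ∈ triplePartitions m avail →
  (∀ {v} → v ∈ map tripleVec P → v ∈ map tripleVec P') → (∀ {v} → v ∈ map tripleVec P' → v ∈ map tripleVec P) →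
  P ≡ P'
triplePartitions-injective {m = zero} {[]} _ (here refl) (here refl) _ _ = refl
triplePartitions-injective {k} {suc m} {a ∷ rest} (a∉ ∷ urest) P∈ P'∈ P⊆P' P'⊆P
  with ∈-triplePartitions⁻ {m = m} {a} {rest} P∈ | ∈-triplePartitions⁻ {m = m} {a} {rest} P'∈
... | led {b} {c} {r} {Q} bcr∈ Q∈ | led {b'} {c'} {_} {Q'} bcr'∈ Q'∈
  with leadingTriple-injective a∉ urest bcr∈ bcr'∈ (leaders-≡ (P⊆P' (here refl)))
  where
  leaders-≡ : tripleVec (a , b , c) ∈ map tripleVec ((a , b' , c') ∷ Q') →
              tripleVec (a , b , c) ≡ tripleVec (a , b' , c')
  leaders-≡ (here v≡v')  = v≡v'
  leaders-≡ (there v∈Q') =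
    ⊥-elim (leader-uncovered a∉ urest {m = m} bcr'∈ Q'∈ v∈Q' (1≤lookup-tripleVec⁺ (a , b , c) (inj₁ refl)))
... | refl = cong ((a , b , c) ∷_) (triplePartitions-injective {m = m} (PickedTwo.Unique-rest Finₚ._≟_ urest bcr∈)
                                       Q∈ Q'∈ (tails P⊆P' Q∈) (tails P'⊆P Q'∈))
  where
  tails : ∀ {Q₁ Q₂} → (∀ {v} → v ∈ map tripleVec ((a , b , c) ∷ Q₁) → v ∈ map tripleVec ((a , b , c) ∷ Q₂)) →
          Q₁ ∈ triplePartitions m r → ∀ {v} → v ∈ map tripleVec Q₁ → v ∈ map tripleVec Q₂
  tails ⊆ Q₁∈ v∈ with ⊆ (there v∈)
  ... | here refl  =
    ⊥-elim (leader-uncovered a∉ urest {m = m} bcr∈ Q₁∈ v∈ (1≤lookup-tripleVec⁺ (a , b , c) (inj₁ refl)))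
  ... | there v∈Q₂ = v∈Q₂

tripleCount : ℕ → ℕ
tripleCount zero    = 1
tripleCount (suc m) = ((2 + 3 * m) C 2) * tripleCount m

length-triplePartitions : ∀ {k} m {avail : List (Fin k)} → Unique avail → length avail ≡ 3 * m →
  length (triplePartitions m avail) ≡ tripleCount m
length-triplePartitions zero    {[]}    _ _ = refl
length-triplePartitions zero    {_ ∷ _} _ ()
length-triplePartitions (suc m) {[]}    _ |avail|≡ with trans |avail|≡ (*-suc 3 m)
... | ()
length-triplePartitions (suc m) {a ∷ rest} (_ ∷ urest) |avail|≡ =
  trans (length-concatMap-const (λ (b , c , r) → map ((a , b , c) ∷_) (triplePartitions m r))
                                (tripleCount m) length-block)
        (cong (_* tripleCount m) (trans (length-pickTwo rest) (cong (_C 2) |rest|≡)))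
  where
  |rest|≡ : length rest ≡ 2 + 3 * m
  |rest|≡ = suc-injective (trans |avail|≡ (*-suc 3 m))
  length-block : ∀ {q} → q ∈ pickTwo rest →
    length (map ((a , proj₁ q , proj₁ (proj₂ q)) ∷_) (triplePartitions m (proj₂ (proj₂ q)))) ≡ tripleCount m
  length-block {b , c , r} bcr∈ =
    trans (Listₚ.length-map _ (triplePartitions m r))
          (length-triplePartitions m Unique-rest (+-cancelˡ-≡ 2 _ _ (trans 2+length-rest |rest|≡)))
    where open PickedTwo Finₚ._≟_ urest bcr∈

[1+r]C2*2≡[1+r]*r : ∀ r → (suc r C 2) * 2 ≡ suc r * r
[1+r]C2*2≡[1+r]*r zero    = refl
[1+r]C2*2≡[1+r]*r (suc r) = begin
  (suc (suc r) C 2) * 2                ≡⟨ cong (_* 2) (nCk+nC[k+1]≡[n+1]C[k+1] (suc r) 1) ⟨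
  (suc r C 1 + suc r C 2) * 2          ≡⟨ *-distribʳ-+ 2 (suc r C 1) (suc r C 2) ⟩
  (suc r C 1) * 2 + (suc r C 2) * 2    ≡⟨ cong₂ (λ u v → u * 2 + v) (nC1≡n (suc r)) ([1+r]C2*2≡[1+r]*r r) ⟩
  suc r * 2 + suc r * r                ≡⟨ *-distribˡ-+ (suc r) 2 r ⟨
  suc r * (2 + r)                      ≡⟨ *-comm (suc r) (2 + r) ⟩
  suc (suc r) * suc r                  ∎
  where open ≡-Reasoning

tripleCount*6ᵐm!≡[3m]! : ∀ m → tripleCount m * (6 ^ m * m !) ≡ (3 * m) !
tripleCount*6ᵐm!≡[3m]! zero    = refl
tripleCount*6ᵐm!≡[3m]! (suc m) = begin
  (p * f) * (6 * 6 ^ m * (suc m * m !))               ≡⟨ regroup p f (6 ^ m) (m !) m ⟩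
  (p * 2) * (3 * suc m) * (f * (6 ^ m * m !))
    ≡⟨ cong₂ (λ u w → u * (3 * suc m) * w) ([1+r]C2*2≡[1+r]*r (suc (3 * m))) (tripleCount*6ᵐm!≡[3m]! m) ⟩
  (2 + 3 * m) * (1 + 3 * m) * (3 * suc m) * (3 * m) ! ≡⟨ unfold m ((3 * m) !) ⟩
  (3 + 3 * m) !                                       ≡⟨ cong _! (*-suc 3 m) ⟨
  (3 * suc m) !                                       ∎
  where
  open ≡-Reasoning
  p = (2 + 3 * m) C 2
  f = tripleCount m
  regroup : ∀ p f y z m → (p * f) * (6 * y * (suc m * z)) ≡ (p * 2) * (3 * suc m) * (f * (y * z))
  regroup = solve-∀
  unfold : ∀ m w → (2 + 3 * m) * (1 + 3 * m) * (3 * suc m) * w ≡ (3 + 3 * m) * ((2 + 3 * m) * ((1 + 3 * m) * w))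
  unfold = solve-∀

formula≡tripleCount : ∀ n → formula n ≡ tripleCount n
formula≡tripleCount n =
  trans (cong (_/ (6 ^ n * n !)) (sym (tripleCount*6ᵐm!≡[3m]! n))) (m*n/n≡m (tripleCount n) (6 ^ n * n !))
  where
  instance
    _ = m^n≢0 6 n
    _ = n !≢0
    _ = m*n≢0 (6 ^ n) (n !)

count-covered≡deg : ∀ {k} (t : Pt k) → IsBinary t → length (filter (λ i → 1 ≤? lookup t i) (allFin k)) ≡ deg t
count-covered≡deg [] _ = refl
count-covered≡deg {suc k} (x ∷ t) (x≤1 VecAll.∷ bt) = begin
  length (filter covered? (allFin (suc k)))                 ≡⟨ length-filter-∷ covered? Fin.zero (List.tabulate Fin.suc) ⟩
  iverson (1 ≤? x) + length (filter covered? (List.tabulate Fin.suc))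
    ≡⟨ cong₂ _+_ (bit x≤1) (cong (length ∘ filter covered?) (sym (Listₚ.map-tabulate id Fin.suc))) ⟩
  x + length (filter covered? (map Fin.suc (allFin k)))     ≡⟨ cong (x +_) (length-filter-map covered? Fin.suc (allFin k)) ⟩
  x + length (filter (λ i → 1 ≤? lookup t i) (allFin k))    ≡⟨ cong (x +_) (count-covered≡deg t bt) ⟩
  x + deg t                                                 ∎
  where
  open ≡-Reasoning
  covered? : Decidable (λ i → 1 ≤ lookup (x ∷ t) i)
  covered? i = 1 ≤? lookup (x ∷ t) i
  bit : ∀ {x} → x ≤ 1 → iverson (1 ≤? x) ≡ x
  bit z≤n       = refl
  bit (s≤s z≤n) = refl

record TripleCover {k} (m : ℕ) (avail : List (Fin k)) (T : List (Pt k)) : Set where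
  field
    binary    : All IsBinary T
    deg≡3     : All (λ t → deg t ≡ 3) T
    disjoint  : AllPairs DisjointSupport T
    length≡   : length T ≡ m
    covered⇒∈ : ∀ {i} → Any (λ t → 1 ≤ lookup t i) T → i ∈ avail
    ∈⇒covered : ∀ {i} → i ∈ avail → Any (λ t → 1 ≤ lookup t i) T

  Unique-T : Unique T
  Unique-T = disjoint∧nonzero⇒Unique disjoint (All.map (λ d≡3 → subst (1 ≤_) (sym d≡3) (s≤s z≤n)) deg≡3)

-- The element of T covering the leading available coordinate a is a triple vector, and
-- removing it leaves a cover of the coordinates it does not cover.
module LeadingElement {k m} {a : Fin k} {rest : List (Fin k)} {T : List (Pt k)}
                      (uavail : Unique (a ∷ rest)) (cov : TripleCover (suc m) (a ∷ rest) T) where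
  open TripleCover cov

  private
    a-cover : ∃ λ t → t ∈ T × 1 ≤ lookup t a
    a-cover = find (∈⇒covered (here refl))

  t₀ : Pt k
  t₀ = proj₁ a-cover

  t₀∈T : t₀ ∈ T
  t₀∈T = proj₁ (proj₂ a-cover)

  covers? : Decidable (λ i → 1 ≤ lookup t₀ i)
  covers? i = 1 ≤? lookup t₀ i

  private
    a∉ : All (a ≢_) rest
    a∉ = AllPairs.head uavail

    t₀-covers-a : 1 ≤ lookup t₀ a
    t₀-covers-a = proj₂ (proj₂ a-cover)

    length-covered : length (filter covers? (a ∷ rest)) ≡ 3
    length-covered = trans
      (unique∧set⇒length-≡ (Uniqueₚ.filter⁺ covers? uavail) (Uniqueₚ.filter⁺ covers? (Uniqueₚ.allFin⁺ k)) (mk⇔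
         (λ i∈ → ∈-filter⁺ covers? (∈-allFin _) (proj₂ (∈-filter⁻ covers? i∈)))
         (λ i∈ → let i-covered = proj₂ (∈-filter⁻ covers? {xs = allFin k} i∈) in
                 ∈-filter⁺ covers? (covered⇒∈ (lose t₀∈T i-covered)) i-covered)))
      (trans (count-covered≡deg t₀ (All.lookup binary t₀∈T)) (All.lookup deg≡3 t₀∈T))

    partners : Σ (Fin k) λ b → Σ (Fin k) λ c → filter covers? rest ≡ b ∷ c ∷ []
    partners = length≡2⇒ (suc-injective
      (trans (cong length (sym (Listₚ.filter-accept covers? {xs = rest} t₀-covers-a))) length-covered))

  b c : Fin k
  b = proj₁ partners
  c = proj₁ (proj₂ partners)

  partners≡ : filter covers? rest ≡ b ∷ c ∷ []
  partners≡ = proj₂ (proj₂ partners)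

  rest' : List (Fin k)
  rest' = filter (¬? ∘ covers?) rest

  bcr∈ : (b , c , rest') ∈ pickTwo rest
  bcr∈ = pickTwo-complete covers? {xs = rest} partners≡

  tripleVec≡t₀ : tripleVec (a , b , c) ≡ t₀
  tripleVec≡t₀ = binary-ext (tripleVec-binary (a , b , c) (All.lookup a∉ b∈xs , All.lookup a∉ c∈xs , b≢c))
                            (All.lookup binary t₀∈T) ⇒t₀ t₀⇒
    where
    open PickedTwo Finₚ._≟_ (AllPairs.tail uavail) bcr∈
    ⇒t₀ : ∀ i → 1 ≤ lookup (tripleVec (a , b , c)) i → 1 ≤ lookup t₀ i
    ⇒t₀ i 1≤ with 1≤lookup-tripleVec⁻ (a , b , c) i 1≤
    ... | inj₁ refl        = t₀-covers-a
    ... | inj₂ (inj₁ refl) = proj₂ (∈-filter⁻ covers? {xs = rest} (subst (b ∈_) (sym partners≡) (here refl)))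
    ... | inj₂ (inj₂ refl) = proj₂ (∈-filter⁻ covers? {xs = rest} (subst (c ∈_) (sym partners≡) (there (here refl))))
    t₀⇒ : ∀ i → 1 ≤ lookup t₀ i → 1 ≤ lookup (tripleVec (a , b , c)) i
    t₀⇒ i 1≤ with covered⇒∈ (lose t₀∈T 1≤)
    ... | here refl = 1≤lookup-tripleVec⁺ (a , b , c) (inj₁ refl)
    ... | there i∈ with subst (i ∈_) partners≡ (∈-filter⁺ covers? i∈ 1≤)
    ... | here refl         = 1≤lookup-tripleVec⁺ (a , b , c) (inj₂ (inj₁ refl))
    ... | there (here refl) = 1≤lookup-tripleVec⁺ (a , b , c) (inj₂ (inj₂ refl))

  T' : List (Pt k)
  T' = filter (λ t → ¬? (t ≟ᵖ t₀)) T

  ∈-T'⁻ : ∀ {t} → t ∈ T' → t ∈ T × t ≢ t₀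
  ∈-T'⁻ = ∈-filter⁻ (λ t → ¬? (t ≟ᵖ t₀))

  ∈-T'⁺ : ∀ {t} → t ∈ T → t ≢ t₀ → t ∈ T'
  ∈-T'⁺ = ∈-filter⁺ (λ t → ¬? (t ≟ᵖ t₀))

  remaining : TripleCover m rest' T'
  remaining = record
    { binary    = All.tabulate (All.lookup binary ∘ proj₁ ∘ ∈-T'⁻)
    ; deg≡3     = All.tabulate (All.lookup deg≡3 ∘ proj₁ ∘ ∈-T'⁻)
    ; disjoint  = AllPairsₚ.filter⁺ _ disjoint
    ; length≡   = suc-injective (trans (sym |T|≡1+|T'|) length≡)
    ; covered⇒∈ = covered⇒∈'
    ; ∈⇒covered = ∈⇒covered'
    }
    where
    |T|≡1+|T'| : length T ≡ suc (length T')
    |T|≡1+|T'| = unique∧set⇒length-≡ Unique-T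
      (All.tabulate (λ t∈ t₀≡t → proj₂ (∈-T'⁻ t∈) (sym t₀≡t)) ∷ Uniqueₚ.filter⁺ _ Unique-T)
      (mk⇔ case-t₀ λ { (here refl) → t₀∈T ; (there t∈) → proj₁ (∈-T'⁻ t∈) })
      where
      case-t₀ : ∀ {t} → t ∈ T → t ∈ t₀ ∷ T'
      case-t₀ {t} t∈ with t ≟ᵖ t₀
      ... | yes refl = here refl
      ... | no  t≢t₀ = there (∈-T'⁺ t∈ t≢t₀)
    covered⇒∈' : ∀ {i} → Any (λ t → 1 ≤ lookup t i) T' → i ∈ rest'
    covered⇒∈' {i} cov' with find cov'
    ... | t , t∈' , 1≤ with ∈-T'⁻ t∈'
    ... | t∈ , t≢t₀ with covers? i
    ... | yes t₀-covers = ⊥-elim (t≢t₀ (disjoint⇒shared-coordinate⇒≡ disjoint t∈ t₀∈T 1≤ t₀-covers))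
    ... | no ¬t₀-covers with covered⇒∈ (lose t∈ 1≤)
    ... | here refl = ⊥-elim (¬t₀-covers t₀-covers-a)
    ... | there i∈  = ∈-filter⁺ (¬? ∘ covers?) i∈ ¬t₀-covers
    ∈⇒covered' : ∀ {i} → i ∈ rest' → Any (λ t → 1 ≤ lookup t i) T'
    ∈⇒covered' i∈ with ∈-filter⁻ (¬? ∘ covers?) {xs = rest} i∈
    ... | i∈rest , ¬t₀-covers with find (∈⇒covered (there i∈rest))
    ... | t , t∈ , 1≤ = lose (∈-T'⁺ t∈ (λ { refl → ¬t₀-covers 1≤ })) 1≤

triplePartitions-complete : ∀ {k m} {avail : List (Fin k)} {T : List (Pt k)} → Unique avail → TripleCover m avail T →
  ∃ λ P → P ∈ triplePartitions m avail ×
          (∀ {v} → v ∈ map tripleVec P → v ∈ T) × (∀ {v} → v ∈ T → v ∈ map tripleVec P)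
triplePartitions-complete {m = zero} {T = _ ∷ _} _ cov with TripleCover.length≡ cov
... | ()
triplePartitions-complete {m = zero} {[]}    {[]} _ _ = [] , here refl , (λ ()) , (λ ())
triplePartitions-complete {m = zero} {_ ∷ _} {[]} _ cov with TripleCover.∈⇒covered cov (here refl)
... | ()
triplePartitions-complete {m = suc m} {[]} {T} _ cov
  with 1≤length⇒∃∈ (subst (1 ≤_) (sym (TripleCover.length≡ cov)) (s≤s z≤n))
... | t , t∈ with deg≥1⇒∃lookup≥1 t (subst (1 ≤_) (sym (All.lookup (TripleCover.deg≡3 cov) t∈)) (s≤s z≤n))
... | i , 1≤ with TripleCover.covered⇒∈ cov (lose t∈ 1≤)
... | ()
triplePartitions-complete {m = suc m} {a ∷ rest} {T} uavail cov
  with triplePartitions-complete (Uniqueₚ.filter⁺ (¬? ∘ covers?) (AllPairs.tail uavail)) remaining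
  where open LeadingElement uavail cov
... | P' , P'∈ , P'⊆T' , T'⊆P' = (a , b , c) ∷ P' , ∈-triplePartitions⁺ {m = m} {rest = rest} bcr∈ P'∈ , ⊆T , T⊆
  where
  open LeadingElement uavail cov
  ⊆T : ∀ {v} → v ∈ map tripleVec ((a , b , c) ∷ P') → v ∈ T
  ⊆T (here refl) = subst (_∈ T) (sym tripleVec≡t₀) t₀∈T
  ⊆T (there v∈)  = proj₁ (∈-T'⁻ (P'⊆T' v∈))
  T⊆ : ∀ {v} → v ∈ T → v ∈ map tripleVec ((a , b , c) ∷ P')
  T⊆ {v} v∈ with v ≟ᵖ t₀
  ... | yes refl = here (sym tripleVec≡t₀)
  ... | no  v≢t₀ = there (T'⊆P' (∈-T'⁺ v∈ v≢t₀))

-- The partitions counted by α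

cubeUnionOf : ∀ {k} → List (Pt k) → List (Pt k)
cubeUnionOf T = filter (λ x → Any.any? (x ≤ᵖ?_) T) (downSet ones)

cubeUnionOf-isCubeUnion : ∀ {k d} {T : List (Pt k)} → All IsBinary T → All (λ t → deg t ≡ d) T →
  AllPairs DisjointSupport T → 1 ≤ length T → IsCubeUnion d (cubeUnionOf T) T
cubeUnionOf-isCubeUnion {T = T} binT degT disjT 1≤|T| = record
  { isPartition = Linkedₚ.AllPairs⇒Linked (AllPairsₚ.filter⁺ below? (sorted-downSet ones)) , downClosed
  ; binary      = binT
  ; deg≡        = degT
  ; disjoint    = disjT
  ; nonEmpty    = 1≤|T|
  ; ∈⇒below     = λ x∈ → proj₂ (∈-filter⁻ below? {xs = downSet ones} x∈)
  ; below⇒∈     = below⇒∈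
  }
  where
  below? : Decidable (Below T)
  below? x = Any.any? (x ≤ᵖ?_) T
  below⇒∈ : ∀ {x} → Below T x → x ∈ cubeUnionOf T
  below⇒∈ b with find b
  ... | t , t∈ , x≤t = ∈-filter⁺ below? (∈-downSet⁺ (≤ᵖ-trans x≤t (binary⇒≤ᵖones (All.lookup binT t∈)))) b
  downClosed : ∀ {x y} → x ∈ cubeUnionOf T → y ≤ᵖ x → y ∈ cubeUnionOf T
  downClosed x∈ y≤x = below⇒∈ (Any.map (≤ᵖ-trans y≤x) (proj₂ (∈-filter⁻ below? {xs = downSet ones} x∈)))

length-3⇒Soc-deg≡3 : ∀ {k} (L : List (Pt k)) → All (λ x → 3 ≤ deg x) (Soc L) → len L ≡ 3 →
  All (λ x → deg x ≡ 3) (Soc L)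
length-3⇒Soc-deg≡3 L 3≤deg len≡3 = All.tabulate (λ {x} x∈S →
  ≤-antisym (subst (deg x ≤_) len≡3 (foldr-⊔-upper deg (proj₁ (∈-filter⁻ (isMaxIn? L) {xs = L} x∈S))))
            (All.lookup 3≤deg x∈S))

length-3⇒|Soc|≡h≥3 : ∀ {k} (L : List (Pt k)) → IsPartition L → All (λ x → 3 ≤ deg x) (Soc L) → len L ≡ 3 →
  length (Soc L) ≡ h≥3 L
length-3⇒|Soc|≡h≥3 {k} L isPart 3≤deg len≡3 =
  unique∧set⇒length-≡ (Uniqueₚ.filter⁺ (isMaxIn? L) uL) (Uniqueₚ.filter⁺ 3≤deg? uL) (mk⇔
    (λ x∈S → ∈-filter⁺ 3≤deg? (proj₁ (∈-filter⁻ (isMaxIn? L) {xs = L} x∈S)) (All.lookup 3≤deg x∈S))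
    (λ x∈ → let x∈L , 3≤dx = ∈-filter⁻ 3≤deg? {xs = L} x∈ in
            ∈-filter⁺ (isMaxIn? L) x∈L (All.tabulate (λ {y} y∈ x≤y →
              ≤ᵖ∧deg≥⇒≡ x≤y (≤-trans (subst (deg y ≤_) len≡3 (foldr-⊔-upper deg y∈)) 3≤dx)))))
  where
  uL : Unique L
  uL = sorted⇒Unique isPart
  3≤deg? : Decidable (λ (x : Pt k) → 3 ≤ deg x)
  3≤deg? x = 3 ≤? deg x

module Enumeration (n : ℕ) (1≤n : 1 ≤ n) where

  families : List (List (Triple (3 * n)))
  families = triplePartitions n (allFin (3 * n))

  partitionOf : List (Triple (3 * n)) → List (Pt (3 * n))
  partitionOf P = cubeUnionOf (map tripleVec P)

  partitions : List (List (Pt (3 * n)))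
  partitions = map partitionOf families

  private
    family : ∀ {P} → P ∈ families → IsTripleFamily n (allFin (3 * n)) P
    family = triplePartitions-sound (Uniqueₚ.allFin⁺ _)

    |tripleVecs|≡n : ∀ {P} → P ∈ families → length (map tripleVec P) ≡ n
    |tripleVecs|≡n {P} P∈ = trans (Listₚ.length-map tripleVec P) (IsTripleFamily.length≡ (family P∈))

  partitionOf-isCubeUnion : ∀ {P} → P ∈ families → IsCubeUnion 3 (partitionOf P) (map tripleVec P)
  partitionOf-isCubeUnion P∈ =
    cubeUnionOf-isCubeUnion (Allₚ.map⁺ binary) (Allₚ.map⁺ (All.tabulate (λ {t} _ → deg-tripleVec t)))
                            (AllPairsₚ.map⁺ disjoint) (subst (1 ≤_) (sym (|tripleVecs|≡n P∈)) 1≤n)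
    where open IsTripleFamily (family P∈)

  ∈partitions⇒valid : ∀ {L} → L ∈ partitions → IsMPartition (3 * n) (3 * n) n L × len L ≡ 3
  ∈partitions⇒valid L∈ with ∈-map⁻ partitionOf L∈
  ... | P , P∈ , refl = cubeUnion₃-isMPartition H (|tripleVecs|≡n P∈) , CubeUnion.len≡d (s≤s z≤n) H
    where
    H : IsCubeUnion 3 (partitionOf P) (map tripleVec P)
    H = partitionOf-isCubeUnion P∈

  valid⇒∈partitions : ∀ {L} → IsMPartition (3 * n) (3 * n) n L × len L ≡ 3 → L ∈ partitions
  valid⇒∈partitions {L} ((isPart , _ , 3≤deg , h₁≡3n , _ , h≥3≡n) , len≡3) =
    subst (_∈ partitions) (sym (cubeUnion-≡ H (partitionOf-isCubeUnion P∈) Soc⊆ ⊆Soc)) (∈-map⁺ partitionOf P∈)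
    where
    |Soc|≡n : length (Soc L) ≡ n
    |Soc|≡n = trans (length-3⇒|Soc|≡h≥3 L isPart 3≤deg len≡3) h≥3≡n
    H : IsCubeUnion 3 L (Soc L)
    H = socle-isCubeUnion₃ 1≤n isPart h₁≡3n |Soc|≡n (length-3⇒Soc-deg≡3 L 3≤deg len≡3)
    cover : TripleCover n (allFin (3 * n)) (Soc L)
    cover = record
      { binary    = IsCubeUnion.binary H
      ; deg≡3     = IsCubeUnion.deg≡ H
      ; disjoint  = IsCubeUnion.disjoint H
      ; length≡   = |Soc|≡n
      ; covered⇒∈ = λ {i} _ → ∈-allFin i
      ; ∈⇒covered = λ {i} _ → socle-covers isPart h₁≡3n i
      }
    complete : ∃ λ P → P ∈ families ×
                       (∀ {v} → v ∈ map tripleVec P → v ∈ Soc L) × (∀ {v} → v ∈ Soc L → v ∈ map tripleVec P)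
    complete = triplePartitions-complete (Uniqueₚ.allFin⁺ _) cover
    P∈ : proj₁ complete ∈ families
    P∈ = proj₁ (proj₂ complete)
    Soc⊆ : ∀ {v} → v ∈ Soc L → v ∈ map tripleVec (proj₁ complete)
    Soc⊆ = proj₂ (proj₂ (proj₂ complete))
    ⊆Soc : ∀ {v} → v ∈ map tripleVec (proj₁ complete) → v ∈ Soc L
    ⊆Soc = proj₁ (proj₂ (proj₂ complete))

  -- A family is recovered from its partition as the socle.
  Unique-partitions : Unique partitions
  Unique-partitions = Unique-map⁺ partitionOf (Unique-triplePartitions {m = n} (Uniqueₚ.allFin⁺ _)) injective
    where
    injective : ∀ {P P'} → P ∈ families → P' ∈ families → partitionOf P ≡ partitionOf P' → P ≡ P'
    injective {P} {P'} P∈ P'∈ L≡L' = triplePartitions-injective {m = n} (Uniqueₚ.allFin⁺ _) P∈ P'∈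
      (λ v∈ → ∈-Soc⁻ H' (subst (λ L → _ ∈ Soc L) L≡L' (∈-Soc⁺ H v∈)))
      (λ v∈ → ∈-Soc⁻ H (subst (λ L → _ ∈ Soc L) (sym L≡L') (∈-Soc⁺ H' v∈)))
      where
      open CubeUnion (s≤s z≤n) using (∈-Soc⁺; ∈-Soc⁻)
      H : IsCubeUnion 3 (partitionOf P) (map tripleVec P)
      H = partitionOf-isCubeUnion P∈
      H' : IsCubeUnion 3 (partitionOf P') (map tripleVec P')
      H' = partitionOf-isCubeUnion P'∈

  length-partitions : length partitions ≡ formula n
  length-partitions = begin
    length partitions  ≡⟨ Listₚ.length-map partitionOf families ⟩
    length families    ≡⟨ length-triplePartitions n (Uniqueₚ.allFin⁺ _) (Listₚ.length-tabulate id) ⟩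
    tripleCount n      ≡⟨ formula≡tripleCount n ⟨
    formula n          ∎
    where open ≡-Reasoning

proposition5p1 : ∀ (n : ℕ) → 1 ≤ n →
    (∀ (L : List (Pt (3 * n))) → IsPartition L → h L 1 ≡ 3 * n →
        length (Soc L) ≡ n → All (λ x → deg x ≡ 3) (Soc L) →
        HilbertIs L (1 ∷ 3 * n ∷ 3 * n ∷ n ∷ []) ×
        IsMPartition (3 * n) (3 * n) n L × len L ≡ 3 × IsCompressed L)
    × αIs (3 * n) (3 * n) n 3 (formula n)
proposition5p1 n 1≤n =
  structure , (partitions , Unique-partitions , (λ _ → mk⇔ ∈partitions⇒valid valid⇒∈partitions) , length-partitions)
  where
  open Enumeration n 1≤n
  structure : ∀ L → IsPartition L → h L 1 ≡ 3 * n → length (Soc L) ≡ n → All (λ x → deg x ≡ 3) (Soc L) →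
    HilbertIs L (1 ∷ 3 * n ∷ 3 * n ∷ n ∷ []) × IsMPartition (3 * n) (3 * n) n L × len L ≡ 3 × IsCompressed L
  structure L isPart h₁≡3n |Soc|≡n Soc-deg≡3 =
    CubeUnion₃.hilbert H |Soc|≡n , cubeUnion₃-isMPartition H |Soc|≡n ,
    CubeUnion₃.len≡d H |Soc|≡n , cubeUnion₃-compressed 1≤n H |Soc|≡n
    where
    H : IsCubeUnion 3 L (Soc L)
    H = socle-isCubeUnion₃ 1≤n isPart h₁≡3n |Soc|≡n Soc-deg≡3
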